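{- Let $\mathbb F_q$ be a finite field of characteristic $p$ and let $S\subseteq\mathbb F_q$ be an $\mathbb F_p$-vector subspace such that $1\in S$ and $a\in S$ for some $a\notin\mathbb F_p$. Then every polynomial $g\in\mathbb F_q[x]$ satisfying $g(x+s)=g(x)$ for all $s\in S$ is of the form $$g(x)=f\big(x^{p^2}-x^p(1+(a-a^p)^{p-1})+x(a-a^p)^{p-1}\big)$$ for some $f\in\mathbb F_q[x]$. -}

module Defs where

open import Level using (Level; _⊔_; suc)
open import Data.Nat as ℕ using (ℕ; zero)
open import Data.Nat.Primality using (Prime)
open import Data.List using (List; []; _∷_; replicate)
open import Data.Product using (Σ; ∃; _×_; _,_)
open import Data.Empty using (⊥)
open import Relation.Nullary using (¬_)
open import Relation.Unary using (Pred)
open import Data.List.Membership.Setoid using () renaming (_∈_ to _∈ₛ_)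
open import Algebra.Bundles using (CommutativeRing)

record IsFieldCR {c ℓ} (R : CommutativeRing c ℓ) : Set (c ⊔ ℓ) where
  open CommutativeRing R
  field
    1≉0     : ¬ (1# ≈ 0#)
    inverse : ∀ x → ¬ (x ≈ 0#) → ∃ λ y → x * y ≈ 1#

module FieldOps {c ℓ} (R : CommutativeRing c ℓ) where
  open CommutativeRing R

  _•_ : ℕ → Carrier → Carrier
  zero • x = 0#
  ℕ.suc n • x = x + (n • x)

  _^_ : Carrier → ℕ → Carrier
  x ^ zero = 1#
  x ^ ℕ.suc n = x * (x ^ n)

  IsFinite : Set (c ⊔ ℓ)
  IsFinite = Σ (List Carrier) λ xs → ∀ x → _∈ₛ_ setoid x xs

  -- characteristic p (p prime, p·1 = 0; then p is the characteristic)
  HasCharacteristic : ℕ → Set ℓ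
  HasCharacteristic p = Prime p × (p • 1# ≈ 0#)

  InPrimeField : Carrier → Set ℓ
  InPrimeField x = ∃ λ n → x ≈ n • 1#

  record IsPrimeSubspace {ℓ′} (S : Pred Carrier ℓ′) : Set (c ⊔ ℓ ⊔ ℓ′) where
    field
      respects : ∀ {x y} → x ≈ y → S x → S y
      zero∈    : S 0#
      +-closed : ∀ {x y} → S x → S y → S (x + y)
      •-closed : ∀ n {x} → S x → S (n • x)

  -- Polynomials in 𝔽_q[x] as coefficient lists, lowest degree first.

  Poly : Set c
  Poly = List Carrier

  infix 4 _≈ₚ_
  data _≈ₚ_ : Poly → Poly → Set (c ⊔ ℓ) where
    []≈[] : [] ≈ₚ []
    ∷≈[]  : ∀ {a as} → a ≈ 0# → as ≈ₚ [] → (a ∷ as) ≈ₚ []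
    []≈∷  : ∀ {b bs} → b ≈ 0# → [] ≈ₚ bs → [] ≈ₚ (b ∷ bs)
    ∷≈∷   : ∀ {a b as bs} → a ≈ b → as ≈ₚ bs → (a ∷ as) ≈ₚ (b ∷ bs)

  const : Carrier → Poly
  const a = a ∷ []

  X : Poly
  X = 0# ∷ 1# ∷ []

  infixl 6 _+ₚ_ _-ₚ_
  infixl 7 _*ₚ_ _·ₚ_

  _+ₚ_ : Poly → Poly → Poly
  [] +ₚ q = q
  (a ∷ p) +ₚ [] = a ∷ p
  (a ∷ p) +ₚ (b ∷ q) = (a + b) ∷ (p +ₚ q)

  _·ₚ_ : Carrier → Poly → Poly
  a ·ₚ [] = []
  a ·ₚ (b ∷ q) = (a * b) ∷ (a ·ₚ q)

  -ₚ_ : Poly → Poly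
  -ₚ p = (- 1#) ·ₚ p

  _-ₚ_ : Poly → Poly → Poly
  p -ₚ q = p +ₚ (-ₚ q)

  _*ₚ_ : Poly → Poly → Poly
  [] *ₚ q = []
  (a ∷ p) *ₚ q = (a ·ₚ q) +ₚ (0# ∷ (p *ₚ q))

  X^ : ℕ → Poly
  X^ n = replicate n 0# Data.List.++ (1# ∷ [])

  -- composition g ∘ h, i.e. the polynomial g(h(x)) (Horner scheme)
  _∘ₚ_ : Poly → Poly → Poly
  [] ∘ₚ h = []
  (c ∷ g) ∘ₚ h = const c +ₚ (h *ₚ (g ∘ₚ h))

{-# OPTIONS --safe #-}
module Submission where

-- W = 𝔽ₚ + 𝔽ₚa ⊆ S has p² elements because a ∉ 𝔽ₚ. L is the polynomial function
-- 𝓛 v = φ(φ v) - (1 + β) φ v + β v, with φ the Frobenius and β = (a - aᵖ)ᵖ⁻¹; 𝓛 is additive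
-- and kills 1 and a, so L vanishes on W. As L(x + w) - L(x) has degree < p² but p² roots,
-- every w ∈ W is a period of L. Dividing a W-periodic g by the monic L gives g = r + k L with
-- deg r < p²; uniqueness of the remainder makes r and k W-periodic, so r takes the single
-- value r(0) on the p² points of W and is constant, and induction on the degree writes
-- k = f ∘ L, whence g = (r(0) + X f) ∘ L.

open import Defs
open import Algebra.Bundles using (CommutativeRing)
open import Algebra.Solver.Ring.AlmostCommutativeRing using (fromCommutativeRing; _-Raw-AlmostCommutative⟶_)
import Algebra.Solver.Ring
open import Data.Nat as ℕ using (ℕ; zero; suc; z≤n; s≤s; _!; _∸_)
  renaming (_≤_ to _≤ℕ_; _<_ to _<ℕ_; _+_ to _+ℕ_; _*_ to _*ℕ_)
import Data.Nat.Properties as ℕ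
open import Algebra.Definitions.RawMagma ℕ.+-rawMagma using (_,_)
open import Data.Nat.Divisibility using (_∣_; divides; ∣⇒≤; m∣m*n; ∣1⇒≡1)
open import Data.Nat.Primality using (Prime; euclidsLemma; prime⇒nonZero; prime⇒nonTrivial)
open import Data.Nat.Combinatorics using (_C_; nCn≡1; nCk≡n!/k![n-k]!; k![n∸k]!∣n!)
open import Data.Nat.DivMod using (_%_; _/_; m%n<n; m≡m%n+[m/n]*n; m/n*n≤m; m/n*n≡m)
open import Data.Nat.GCD using (module Bézout)
open import Data.Nat.Coprimality using (prime⇒coprime; coprime-Bézout)
open import Data.Integer as ℤ using (ℤ; +_; -[1+_]; _⊖_)
import Data.Integer.Properties as ℤ
open import Data.Sign as Sign using (Sign)
open import Data.Fin as Fin using (Fin; toℕ; fromℕ; inject₁)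
import Data.Fin.Properties as Fin
open import Data.Vec.Functional using (Vector)
open import Data.List using ([]; _∷_; length; drop)
open import Data.Maybe using (Maybe; just; nothing)
open import Data.Product using (Σ; ∃; ∃₂; _,_; _×_; proj₁; proj₂)
open import Data.Sum using (inj₁; inj₂)
open import Data.Empty using (⊥-elim)
open import Function using (_∘_)
open import Level using (_⊔_)
open import Relation.Nullary using (¬_; yes; no)
open import Relation.Unary using (Pred)
open import Relation.Binary.Bundles using (Setoid)
open import Relation.Binary.PropositionalEquality as ≡ using (_≡_; _≢_)
import Relation.Binary.Reasoning.Setoid as SetoidReasoning

-- Algebra.Solver.Ring needs a coefficient ring with decidable equality; ℤ maps into every ring.
module IntegerRingSolver {c ℓ} (R : CommutativeRing c ℓ) where

  open CommutativeRing R
  open import Algebra.Properties.Ring ring using (-0#≈0#; -‿involutive; -‿+-comm; -1*x≈-x)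
  open import Algebra.Properties.Semiring.Mult semiring using (×-homo-+; ×1-homo-*) renaming (_×_ to _×ᴹ_)
  open import Algebra.Properties.CommutativeSemigroup +-commutativeSemigroup using (interchange)
  open import Algebra.Properties.CommutativeSemigroup *-commutativeSemigroup
    using () renaming (interchange to *-interchange)
  open import Relation.Binary.Reasoning.Setoid setoid

  private
    ⟦_⟧ℤ : ℤ → Carrier
    ⟦ + n ⟧ℤ      = n ×ᴹ 1#
    ⟦ -[1+ n ] ⟧ℤ = - (suc n ×ᴹ 1#)

    ⟦sign⟧ : Sign → Carrier
    ⟦sign⟧ Sign.+ = 1#
    ⟦sign⟧ Sign.- = - 1#

    ⟦⟧ℤ-sign-abs : ∀ i → ⟦ i ⟧ℤ ≈ ⟦sign⟧ (ℤ.sign i) * (ℤ.∣ i ∣ ×ᴹ 1#)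
    ⟦⟧ℤ-sign-abs (+ n)    = sym (*-identityˡ _)
    ⟦⟧ℤ-sign-abs -[1+ n ] = sym (-1*x≈-x _)

    ⟦⟧ℤ-◃ : ∀ s n → ⟦ s ℤ.◃ n ⟧ℤ ≈ ⟦sign⟧ s * (n ×ᴹ 1#)
    ⟦⟧ℤ-◃ _      zero    = sym (zeroʳ _)
    ⟦⟧ℤ-◃ Sign.- (suc n) = sym (-1*x≈-x _)
    ⟦⟧ℤ-◃ Sign.+ (suc n) = sym (*-identityˡ _)

    ⟦sign⟧-* : ∀ s t → ⟦sign⟧ (s Sign.* t) ≈ ⟦sign⟧ s * ⟦sign⟧ t
    ⟦sign⟧-* Sign.- Sign.- = sym (trans (-1*x≈-x _) (-‿involutive _))
    ⟦sign⟧-* Sign.- Sign.+ = sym (*-identityʳ _)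
    ⟦sign⟧-* Sign.+ _      = sym (*-identityˡ _)

    ⟦⟧ℤ-⊖ : ∀ m n → ⟦ m ⊖ n ⟧ℤ ≈ m ×ᴹ 1# - n ×ᴹ 1#
    ⟦⟧ℤ-⊖ zero    zero    = sym (-‿inverseʳ 0#)
    ⟦⟧ℤ-⊖ zero    (suc n) = sym (+-identityˡ _)
    ⟦⟧ℤ-⊖ (suc m) zero    = sym (trans (+-congˡ -0#≈0#) (+-identityʳ _))
    ⟦⟧ℤ-⊖ (suc m) (suc n) = begin
      ⟦ suc m ⊖ suc n ⟧ℤ                 ≡⟨ ≡.cong ⟦_⟧ℤ (ℤ.[1+m]⊖[1+n]≡m⊖n m n) ⟩
      ⟦ m ⊖ n ⟧ℤ                         ≈⟨ ⟦⟧ℤ-⊖ m n ⟩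
      m ×ᴹ 1# - n ×ᴹ 1#                  ≈⟨ cancel-1 ⟨
      (1# + m ×ᴹ 1#) + (- 1# - n ×ᴹ 1#)  ≈⟨ +-congˡ (-‿+-comm 1# (n ×ᴹ 1#)) ⟩
      suc m ×ᴹ 1# - suc n ×ᴹ 1#          ∎
      where
      cancel-1 : (1# + m ×ᴹ 1#) + (- 1# - n ×ᴹ 1#) ≈ m ×ᴹ 1# - n ×ᴹ 1#
      cancel-1 = trans (interchange 1# _ (- 1#) _)
                       (trans (+-congʳ (-‿inverseʳ 1#)) (+-identityˡ _))

    ⟦⟧ℤ-homo-+ : ∀ i j → ⟦ i ℤ.+ j ⟧ℤ ≈ ⟦ i ⟧ℤ + ⟦ j ⟧ℤ
    ⟦⟧ℤ-homo-+ -[1+ m ] -[1+ n ] = begin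
      - (suc (suc (m ℕ.+ n)) ×ᴹ 1#)  ≡⟨ ≡.cong (λ k → - (k ×ᴹ 1#)) (≡.sym (ℕ.+-suc (suc m) n)) ⟩
      - ((suc m ℕ.+ suc n) ×ᴹ 1#)    ≈⟨ -‿cong (×-homo-+ 1# (suc m) (suc n)) ⟩
      - (suc m ×ᴹ 1# + suc n ×ᴹ 1#)  ≈⟨ -‿+-comm _ _ ⟨
      ⟦ -[1+ m ] ⟧ℤ + ⟦ -[1+ n ] ⟧ℤ  ∎
    ⟦⟧ℤ-homo-+ -[1+ m ] (+ n)    = trans (⟦⟧ℤ-⊖ n (suc m)) (+-comm _ _)
    ⟦⟧ℤ-homo-+ (+ m)    -[1+ n ] = ⟦⟧ℤ-⊖ m (suc n)
    ⟦⟧ℤ-homo-+ (+ m)    (+ n)    = ×-homo-+ 1# m n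

    ⟦⟧ℤ-homo-* : ∀ i j → ⟦ i ℤ.* j ⟧ℤ ≈ ⟦ i ⟧ℤ * ⟦ j ⟧ℤ
    ⟦⟧ℤ-homo-* i j = begin
      ⟦ i ℤ.* j ⟧ℤ
        ≈⟨ ⟦⟧ℤ-◃ (ℤ.sign i Sign.* ℤ.sign j) (ℤ.∣ i ∣ ℕ.* ℤ.∣ j ∣) ⟩
      ⟦sign⟧ (ℤ.sign i Sign.* ℤ.sign j) * ((ℤ.∣ i ∣ ℕ.* ℤ.∣ j ∣) ×ᴹ 1#)
        ≈⟨ *-cong (⟦sign⟧-* (ℤ.sign i) (ℤ.sign j)) (×1-homo-* ℤ.∣ i ∣ ℤ.∣ j ∣) ⟩
      (⟦sign⟧ (ℤ.sign i) * ⟦sign⟧ (ℤ.sign j)) * ((ℤ.∣ i ∣ ×ᴹ 1#) * (ℤ.∣ j ∣ ×ᴹ 1#))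
        ≈⟨ *-interchange _ _ _ _ ⟩
      (⟦sign⟧ (ℤ.sign i) * (ℤ.∣ i ∣ ×ᴹ 1#)) * (⟦sign⟧ (ℤ.sign j) * (ℤ.∣ j ∣ ×ᴹ 1#))
        ≈⟨ *-cong (⟦⟧ℤ-sign-abs i) (⟦⟧ℤ-sign-abs j) ⟨
      ⟦ i ⟧ℤ * ⟦ j ⟧ℤ ∎

    ⟦⟧ℤ-homo-- : ∀ i → ⟦ ℤ.- i ⟧ℤ ≈ - ⟦ i ⟧ℤ
    ⟦⟧ℤ-homo-- (+ zero)  = sym -0#≈0#
    ⟦⟧ℤ-homo-- (+ suc n) = refl
    ⟦⟧ℤ-homo-- -[1+ n ]  = sym (-‿involutive _)

    ℤ⟶R : ℤ.+-*-rawRing -Raw-AlmostCommutative⟶ fromCommutativeRing R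
    ℤ⟶R = record
      { ⟦_⟧ = ⟦_⟧ℤ ; +-homo = ⟦⟧ℤ-homo-+ ; *-homo = ⟦⟧ℤ-homo-* ; -‿homo = ⟦⟧ℤ-homo--
      ; 0-homo = refl ; 1-homo = +-identityʳ 1# }

    ⟦⟧ℤ-≟ : ∀ i j → Maybe (⟦ i ⟧ℤ ≈ ⟦ j ⟧ℤ)
    ⟦⟧ℤ-≟ i j with i ℤ.≟ j
    ... | yes ≡.refl = just refl
    ... | no _       = nothing

  open Algebra.Solver.Ring ℤ.+-*-rawRing (fromCommutativeRing R) ℤ⟶R ⟦⟧ℤ-≟ public

module Polynomials {c ℓ} (R : CommutativeRing c ℓ) where

  open CommutativeRing R
  open FieldOps R
  open IntegerRingSolver R using (solve; _:=_; _:+_; _:*_; _:-_; con)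
  open import Algebra.Properties.Ring ring using (-1*x≈-x)
  open import Algebra.Properties.AbelianGroup +-abelianGroup using (x∙y⁻¹≈ε⇒x≈y)
  open import Algebra.Properties.CommutativeSemigroup +-commutativeSemigroup
    using (interchange; x∙yz≈y∙xz)
  module ≈-Reasoning = SetoidReasoning setoid

  coeff : Poly → ℕ → Carrier
  coeff []       _       = 0#
  coeff (a ∷ _)  zero    = a
  coeff (_ ∷ as) (suc i) = coeff as i

  ≈ₚ-by-coeff : ∀ x y → (∀ i → coeff x i ≈ coeff y i) → x ≈ₚ y
  ≈ₚ-by-coeff []      []      h = []≈[]
  ≈ₚ-by-coeff []      (b ∷ y) h = []≈∷ (sym (h 0)) (≈ₚ-by-coeff [] y λ i → h (suc i))
  ≈ₚ-by-coeff (a ∷ x) []      h = ∷≈[] (h 0) (≈ₚ-by-coeff x [] λ i → h (suc i))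
  ≈ₚ-by-coeff (a ∷ x) (b ∷ y) h = ∷≈∷ (h 0) (≈ₚ-by-coeff x y λ i → h (suc i))

  coeff-cong : ∀ {x y} → x ≈ₚ y → ∀ i → coeff x i ≈ coeff y i
  coeff-cong []≈[]       _       = refl
  coeff-cong (∷≈[] a≈0 _) zero    = a≈0
  coeff-cong (∷≈[] _ e)   (suc i) = coeff-cong e i
  coeff-cong ([]≈∷ b≈0 _) zero    = sym b≈0
  coeff-cong ([]≈∷ _ e)   (suc i) = coeff-cong e i
  coeff-cong (∷≈∷ a≈b _)  zero    = a≈b
  coeff-cong (∷≈∷ _ e)    (suc i) = coeff-cong e i

  ≈ₚ-refl : ∀ {x} → x ≈ₚ x
  ≈ₚ-refl {x} = ≈ₚ-by-coeff x x λ _ → refl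

  ≈ₚ-sym : ∀ {x y} → x ≈ₚ y → y ≈ₚ x
  ≈ₚ-sym {x} {y} e = ≈ₚ-by-coeff y x λ i → sym (coeff-cong e i)

  ≈ₚ-trans : ∀ {x y z} → x ≈ₚ y → y ≈ₚ z → x ≈ₚ z
  ≈ₚ-trans {x} {_} {z} e f = ≈ₚ-by-coeff x z λ i → trans (coeff-cong e i) (coeff-cong f i)

  ≈ₚ-setoid : Setoid c (c ⊔ ℓ)
  ≈ₚ-setoid = record
    { Carrier = Poly ; _≈_ = _≈ₚ_
    ; isEquivalence = record { refl = ≈ₚ-refl ; sym = ≈ₚ-sym ; trans = ≈ₚ-trans } }

  module ≈ₚ-Reasoning = SetoidReasoning ≈ₚ-setoid

  coeff-+ₚ : ∀ x y i → coeff (x +ₚ y) i ≈ coeff x i + coeff y i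
  coeff-+ₚ []      y       i       = sym (+-identityˡ _)
  coeff-+ₚ (a ∷ x) []      i       = sym (+-identityʳ _)
  coeff-+ₚ (a ∷ x) (b ∷ y) zero    = refl
  coeff-+ₚ (a ∷ x) (b ∷ y) (suc i) = coeff-+ₚ x y i

  coeff-·ₚ : ∀ a x i → coeff (a ·ₚ x) i ≈ a * coeff x i
  coeff-·ₚ a []      i       = sym (zeroʳ a)
  coeff-·ₚ a (b ∷ x) zero    = refl
  coeff-·ₚ a (b ∷ x) (suc i) = coeff-·ₚ a x i

  +ₚ-cong : ∀ {x x′ y y′} → x ≈ₚ x′ → y ≈ₚ y′ → x +ₚ y ≈ₚ x′ +ₚ y′
  +ₚ-cong {x} {x′} {y} {y′} e f = ≈ₚ-by-coeff _ _ λ i → begin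
    coeff (x +ₚ y) i         ≈⟨ coeff-+ₚ x y i ⟩
    coeff x i + coeff y i    ≈⟨ +-cong (coeff-cong e i) (coeff-cong f i) ⟩
    coeff x′ i + coeff y′ i  ≈⟨ coeff-+ₚ x′ y′ i ⟨
    coeff (x′ +ₚ y′) i       ∎
    where open ≈-Reasoning

  +ₚ-congˡ : ∀ x {y y′} → y ≈ₚ y′ → x +ₚ y ≈ₚ x +ₚ y′
  +ₚ-congˡ x = +ₚ-cong ≈ₚ-refl

  +ₚ-congʳ : ∀ {x x′} y → x ≈ₚ x′ → x +ₚ y ≈ₚ x′ +ₚ y
  +ₚ-congʳ y e = +ₚ-cong e ≈ₚ-refl

  ·ₚ-cong : ∀ {a b x y} → a ≈ b → x ≈ₚ y → a ·ₚ x ≈ₚ b ·ₚ y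
  ·ₚ-cong {a} {b} {x} {y} e f = ≈ₚ-by-coeff _ _ λ i → begin
    coeff (a ·ₚ x) i  ≈⟨ coeff-·ₚ a x i ⟩
    a * coeff x i     ≈⟨ *-cong e (coeff-cong f i) ⟩
    b * coeff y i     ≈⟨ coeff-·ₚ b y i ⟨
    coeff (b ·ₚ y) i  ∎
    where open ≈-Reasoning

  ·ₚ-identityˡ : ∀ x → 1# ·ₚ x ≈ₚ x
  ·ₚ-identityˡ x = ≈ₚ-by-coeff _ _ λ i → trans (coeff-·ₚ 1# x i) (*-identityˡ _)

  ·ₚ-zeroˡ : ∀ {a} x → a ≈ 0# → a ·ₚ x ≈ₚ []
  ·ₚ-zeroˡ {a} x a≈0 = ≈ₚ-by-coeff _ _ λ i →
    trans (coeff-·ₚ a x i) (trans (*-congʳ a≈0) (zeroˡ _))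

  +ₚ-identityʳ : ∀ x → x +ₚ [] ≈ₚ x
  +ₚ-identityʳ []      = []≈[]
  +ₚ-identityʳ (a ∷ x) = ≈ₚ-refl

  +ₚ-assoc : ∀ x y z → (x +ₚ y) +ₚ z ≈ₚ x +ₚ (y +ₚ z)
  +ₚ-assoc x y z = ≈ₚ-by-coeff _ _ λ i → begin
    coeff ((x +ₚ y) +ₚ z) i              ≈⟨ coeff-+ₚ (x +ₚ y) z i ⟩
    coeff (x +ₚ y) i + coeff z i         ≈⟨ +-congʳ (coeff-+ₚ x y i) ⟩
    (coeff x i + coeff y i) + coeff z i  ≈⟨ +-assoc _ _ _ ⟩
    coeff x i + (coeff y i + coeff z i)  ≈⟨ +-congˡ (coeff-+ₚ y z i) ⟨
    coeff x i + coeff (y +ₚ z) i         ≈⟨ coeff-+ₚ x (y +ₚ z) i ⟨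
    coeff (x +ₚ (y +ₚ z)) i              ∎
    where open ≈-Reasoning

  +ₚ-interchange : ∀ x y z w → (x +ₚ y) +ₚ (z +ₚ w) ≈ₚ (x +ₚ z) +ₚ (y +ₚ w)
  +ₚ-interchange x y z w = ≈ₚ-by-coeff _ _ λ i → begin
    coeff ((x +ₚ y) +ₚ (z +ₚ w)) i
      ≈⟨ trans (coeff-+ₚ (x +ₚ y) _ i) (+-cong (coeff-+ₚ x y i) (coeff-+ₚ z w i)) ⟩
    (coeff x i + coeff y i) + (coeff z i + coeff w i)
      ≈⟨ interchange _ _ _ _ ⟩
    (coeff x i + coeff z i) + (coeff y i + coeff w i)
      ≈⟨ trans (coeff-+ₚ (x +ₚ z) _ i) (+-cong (coeff-+ₚ x z i) (coeff-+ₚ y w i)) ⟨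
    coeff ((x +ₚ z) +ₚ (y +ₚ w)) i ∎
    where open ≈-Reasoning

  +ₚ-leftComm : ∀ x y z → x +ₚ (y +ₚ z) ≈ₚ y +ₚ (x +ₚ z)
  +ₚ-leftComm x y z = ≈ₚ-by-coeff _ _ λ i → begin
    coeff (x +ₚ (y +ₚ z)) i
      ≈⟨ trans (coeff-+ₚ x _ i) (+-congˡ (coeff-+ₚ y z i)) ⟩
    coeff x i + (coeff y i + coeff z i)
      ≈⟨ x∙yz≈y∙xz _ _ _ ⟩
    coeff y i + (coeff x i + coeff z i)
      ≈⟨ trans (coeff-+ₚ y _ i) (+-congˡ (coeff-+ₚ x z i)) ⟨
    coeff (y +ₚ (x +ₚ z)) i ∎
    where open ≈-Reasoning

  ·ₚ-distribˡ : ∀ a x y → a ·ₚ (x +ₚ y) ≈ₚ a ·ₚ x +ₚ a ·ₚ y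
  ·ₚ-distribˡ a x y = ≈ₚ-by-coeff _ _ λ i → begin
    coeff (a ·ₚ (x +ₚ y)) i            ≈⟨ trans (coeff-·ₚ a (x +ₚ y) i) (*-congˡ (coeff-+ₚ x y i)) ⟩
    a * (coeff x i + coeff y i)        ≈⟨ distribˡ a _ _ ⟩
    a * coeff x i + a * coeff y i      ≈⟨ trans (coeff-+ₚ (a ·ₚ x) _ i) (+-cong (coeff-·ₚ a x i) (coeff-·ₚ a y i)) ⟨
    coeff (a ·ₚ x +ₚ a ·ₚ y) i         ∎
    where open ≈-Reasoning

  ·ₚ-distribʳ : ∀ a b x → (a + b) ·ₚ x ≈ₚ a ·ₚ x +ₚ b ·ₚ x
  ·ₚ-distribʳ a b x = ≈ₚ-by-coeff _ _ λ i → begin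
    coeff ((a + b) ·ₚ x) i             ≈⟨ coeff-·ₚ (a + b) x i ⟩
    (a + b) * coeff x i                ≈⟨ distribʳ _ a b ⟩
    a * coeff x i + b * coeff x i      ≈⟨ trans (coeff-+ₚ (a ·ₚ x) _ i) (+-cong (coeff-·ₚ a x i) (coeff-·ₚ b x i)) ⟨
    coeff (a ·ₚ x +ₚ b ·ₚ x) i         ∎
    where open ≈-Reasoning

  ·ₚ-assoc : ∀ a b x → (a * b) ·ₚ x ≈ₚ a ·ₚ (b ·ₚ x)
  ·ₚ-assoc a b x = ≈ₚ-by-coeff _ _ λ i → begin
    coeff ((a * b) ·ₚ x) i    ≈⟨ coeff-·ₚ (a * b) x i ⟩
    (a * b) * coeff x i       ≈⟨ *-assoc a b _ ⟩
    a * (b * coeff x i)       ≈⟨ trans (coeff-·ₚ a (b ·ₚ x) i) (*-congˡ (coeff-·ₚ b x i)) ⟨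
    coeff (a ·ₚ (b ·ₚ x)) i   ∎
    where open ≈-Reasoning

  coeff--ₚ : ∀ x y i → coeff (x -ₚ y) i ≈ coeff x i - coeff y i
  coeff--ₚ x y i = trans (coeff-+ₚ x _ i) (+-congˡ (trans (coeff-·ₚ (- 1#) y i) (-1*x≈-x _)))

  -ₚ-inverseʳ : ∀ x → x -ₚ x ≈ₚ []
  -ₚ-inverseʳ x = ≈ₚ-by-coeff _ _ λ i → trans (coeff--ₚ x x i) (-‿inverseʳ _)

  -ₚ-+ₚ : ∀ x y → (x -ₚ y) +ₚ y ≈ₚ x
  -ₚ-+ₚ x y = ≈ₚ-by-coeff _ _ λ i →
    trans (coeff-+ₚ (x -ₚ y) y i) (trans (+-congʳ (coeff--ₚ x y i))
      (solve 2 (λ x y → (x :- y) :+ y := x) refl (coeff x i) (coeff y i)))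

  +ₚ--ₚ-cancelˡ : ∀ x y z w → (x +ₚ (y +ₚ z)) -ₚ (x +ₚ w) ≈ₚ y +ₚ (z -ₚ w)
  +ₚ--ₚ-cancelˡ x y z w = ≈ₚ-by-coeff _ _ λ i → begin
    coeff ((x +ₚ (y +ₚ z)) -ₚ (x +ₚ w)) i
      ≈⟨ trans (coeff--ₚ (x +ₚ (y +ₚ z)) (x +ₚ w) i)
               (+-cong (trans (coeff-+ₚ x (y +ₚ z) i) (+-congˡ (coeff-+ₚ y z i))) (-‿cong (coeff-+ₚ x w i))) ⟩
    (coeff x i + (coeff y i + coeff z i)) - (coeff x i + coeff w i)
      ≈⟨ solve 4 (λ x y z w → (x :+ (y :+ z)) :- (x :+ w) := y :+ (z :- w)) refl _ _ _ _ ⟩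
    coeff y i + (coeff z i - coeff w i)
      ≈⟨ trans (coeff-+ₚ y _ i) (+-congˡ (coeff--ₚ z w i)) ⟨
    coeff (y +ₚ (z -ₚ w)) i ∎
    where open ≈-Reasoning

  -ₚ-interchange : ∀ x y z w → (x +ₚ y) -ₚ (z +ₚ w) ≈ₚ (x -ₚ z) +ₚ (y -ₚ w)
  -ₚ-interchange x y z w = ≈ₚ-by-coeff _ _ λ i → begin
    coeff ((x +ₚ y) -ₚ (z +ₚ w)) i
      ≈⟨ trans (coeff--ₚ (x +ₚ y) (z +ₚ w) i) (+-cong (coeff-+ₚ x y i) (-‿cong (coeff-+ₚ z w i))) ⟩
    (coeff x i + coeff y i) - (coeff z i + coeff w i)
      ≈⟨ solve 4 (λ x y z w → (x :+ y) :- (z :+ w) := (x :- z) :+ (y :- w)) refl _ _ _ _ ⟩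
    (coeff x i - coeff z i) + (coeff y i - coeff w i)
      ≈⟨ trans (coeff-+ₚ (x -ₚ z) (y -ₚ w) i) (+-cong (coeff--ₚ x z i) (coeff--ₚ y w i)) ⟨
    coeff ((x -ₚ z) +ₚ (y -ₚ w)) i ∎
    where open ≈-Reasoning

  -ₚ≈[]⇒≈ : ∀ x y → x -ₚ y ≈ₚ [] → x ≈ₚ y
  -ₚ≈[]⇒≈ x y x-y≈0 = ≈ₚ-by-coeff x y λ i →
    x∙y⁻¹≈ε⇒x≈y _ _ (trans (sym (coeff--ₚ x y i)) (coeff-cong x-y≈0 i))

  -ₚ-+ₚ-cancel : ∀ x y z → (x -ₚ y) +ₚ (y +ₚ z) ≈ₚ x +ₚ z
  -ₚ-+ₚ-cancel x y z = ≈ₚ-by-coeff _ _ λ i → begin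
    coeff ((x -ₚ y) +ₚ (y +ₚ z)) i
      ≈⟨ trans (coeff-+ₚ (x -ₚ y) _ i) (+-cong (coeff--ₚ x y i) (coeff-+ₚ y z i)) ⟩
    (coeff x i - coeff y i) + (coeff y i + coeff z i)
      ≈⟨ solve 3 (λ x y z → (x :- y) :+ (y :+ z) := x :+ z) refl _ _ _ ⟩
    coeff x i + coeff z i
      ≈⟨ coeff-+ₚ x z i ⟨
    coeff (x +ₚ z) i ∎
    where open ≈-Reasoning

  -- (a ∷ x) *ₚ z unfolds to a ·ₚ z +ₚ X· (x *ₚ z).
  X·_ : Poly → Poly
  X· w = 0# ∷ w

  X·-cong : ∀ {x y} → x ≈ₚ y → X· x ≈ₚ X· y
  X·-cong = ∷≈∷ refl

  X·-[] : X· [] ≈ₚ []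
  X·-[] = ∷≈[] refl []≈[]

  X·-+ₚ : ∀ x y → X· (x +ₚ y) ≈ₚ X· x +ₚ X· y
  X·-+ₚ x y = ∷≈∷ (sym (+-identityʳ 0#)) ≈ₚ-refl

  X·-·ₚ : ∀ a x → X· (a ·ₚ x) ≈ₚ a ·ₚ X· x
  X·-·ₚ a x = ∷≈∷ (sym (zeroʳ a)) ≈ₚ-refl

  X·-injective : ∀ {x} → X· x ≈ₚ [] → x ≈ₚ []
  X·-injective (∷≈[] _ x≈[]) = x≈[]

  X·-drop1 : ∀ x → coeff x 0 ≈ 0# → x ≈ₚ X· (drop 1 x)
  X·-drop1 []      _   = ≈ₚ-sym X·-[]
  X·-drop1 (a ∷ x) a≈0 = ∷≈∷ a≈0 ≈ₚ-refl

  *ₚ-congˡ : ∀ {x y} z → x ≈ₚ y → x *ₚ z ≈ₚ y *ₚ z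
  *ₚ-congˡ z []≈[]        = []≈[]
  *ₚ-congˡ z (∷≈[] a≈0 e) =
    ≈ₚ-trans (+ₚ-cong (·ₚ-zeroˡ z a≈0) (≈ₚ-trans (X·-cong (*ₚ-congˡ z e)) X·-[])) []≈[]
  *ₚ-congˡ z ([]≈∷ b≈0 e) = ≈ₚ-sym
    (≈ₚ-trans (+ₚ-cong (·ₚ-zeroˡ z b≈0) (≈ₚ-trans (X·-cong (≈ₚ-sym (*ₚ-congˡ z e))) X·-[])) []≈[])
  *ₚ-congˡ z (∷≈∷ a≈b e)  = +ₚ-cong (·ₚ-cong a≈b ≈ₚ-refl) (X·-cong (*ₚ-congˡ z e))

  *ₚ-zeroʳ : ∀ x → x *ₚ [] ≈ₚ []
  *ₚ-zeroʳ []      = []≈[]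
  *ₚ-zeroʳ (a ∷ x) = ∷≈[] refl (*ₚ-zeroʳ x)

  *ₚ-distribʳ : ∀ x y z → (x +ₚ y) *ₚ z ≈ₚ x *ₚ z +ₚ y *ₚ z
  *ₚ-distribʳ []      y       z = ≈ₚ-refl
  *ₚ-distribʳ (a ∷ x) []      z = ≈ₚ-sym (+ₚ-identityʳ _)
  *ₚ-distribʳ (a ∷ x) (b ∷ y) z = begin
    (a + b) ·ₚ z +ₚ X· ((x +ₚ y) *ₚ z)
      ≈⟨ +ₚ-cong (·ₚ-distribʳ a b z) (≈ₚ-trans (X·-cong (*ₚ-distribʳ x y z)) (X·-+ₚ (x *ₚ z) (y *ₚ z))) ⟩
    (a ·ₚ z +ₚ b ·ₚ z) +ₚ (X· (x *ₚ z) +ₚ X· (y *ₚ z))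
      ≈⟨ +ₚ-interchange (a ·ₚ z) (b ·ₚ z) (X· (x *ₚ z)) (X· (y *ₚ z)) ⟩
    (a ·ₚ z +ₚ X· (x *ₚ z)) +ₚ (b ·ₚ z +ₚ X· (y *ₚ z)) ∎
    where open ≈ₚ-Reasoning

  ·ₚ-*ₚ : ∀ a x z → (a ·ₚ x) *ₚ z ≈ₚ a ·ₚ (x *ₚ z)
  ·ₚ-*ₚ a []      z = []≈[]
  ·ₚ-*ₚ a (b ∷ x) z = begin
    (a * b) ·ₚ z +ₚ X· ((a ·ₚ x) *ₚ z)  ≈⟨ +ₚ-cong (·ₚ-assoc a b z) (≈ₚ-trans (X·-cong (·ₚ-*ₚ a x z)) (X·-·ₚ a _)) ⟩
    a ·ₚ (b ·ₚ z) +ₚ a ·ₚ X· (x *ₚ z)   ≈⟨ ·ₚ-distribˡ a (b ·ₚ z) (X· (x *ₚ z)) ⟨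
    a ·ₚ (b ·ₚ z +ₚ X· (x *ₚ z))        ∎
    where open ≈ₚ-Reasoning

  *ₚ-∷ʳ : ∀ x b y → x *ₚ (b ∷ y) ≈ₚ b ·ₚ x +ₚ X· (x *ₚ y)
  *ₚ-∷ʳ []      b y = []≈∷ refl []≈[]
  *ₚ-∷ʳ (a ∷ x) b y = begin
    (a * b ∷ a ·ₚ y) +ₚ X· (x *ₚ (b ∷ y))           ≈⟨ +ₚ-congˡ (a * b ∷ a ·ₚ y) (X·-cong (*ₚ-∷ʳ x b y)) ⟩
    (a * b + 0#) ∷ (a ·ₚ y +ₚ (b ·ₚ x +ₚ X· (x *ₚ y))) ≈⟨ ∷≈∷ (+-congʳ (*-comm a b)) (+ₚ-leftComm (a ·ₚ y) (b ·ₚ x) (X· (x *ₚ y))) ⟩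
    (b * a + 0#) ∷ (b ·ₚ x +ₚ (a ·ₚ y +ₚ X· (x *ₚ y))) ∎
    where open ≈ₚ-Reasoning

  *ₚ-comm : ∀ x y → x *ₚ y ≈ₚ y *ₚ x
  *ₚ-comm []      y = ≈ₚ-sym (*ₚ-zeroʳ y)
  *ₚ-comm (a ∷ x) y = ≈ₚ-trans (+ₚ-congˡ (a ·ₚ y) (X·-cong (*ₚ-comm x y))) (≈ₚ-sym (*ₚ-∷ʳ y a x))

  *ₚ-congʳ : ∀ x {y z} → y ≈ₚ z → x *ₚ y ≈ₚ x *ₚ z
  *ₚ-congʳ x {y} {z} e = ≈ₚ-trans (*ₚ-comm x y) (≈ₚ-trans (*ₚ-congˡ x e) (*ₚ-comm z x))

  *ₚ-distribˡ : ∀ x y z → x *ₚ (y +ₚ z) ≈ₚ x *ₚ y +ₚ x *ₚ z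
  *ₚ-distribˡ x y z =
    ≈ₚ-trans (*ₚ-comm x _) (≈ₚ-trans (*ₚ-distribʳ y z x) (+ₚ-cong (*ₚ-comm y x) (*ₚ-comm z x)))

  *ₚ-·ₚ : ∀ x a y → x *ₚ (a ·ₚ y) ≈ₚ a ·ₚ (x *ₚ y)
  *ₚ-·ₚ x a y = ≈ₚ-trans (*ₚ-comm x _) (≈ₚ-trans (·ₚ-*ₚ a y x) (·ₚ-cong refl (*ₚ-comm y x)))

  X·-*ₚ : ∀ x z → (X· x) *ₚ z ≈ₚ X· (x *ₚ z)
  X·-*ₚ x z = ≈ₚ-trans (+ₚ-congʳ (X· (x *ₚ z)) (·ₚ-zeroˡ z refl)) ≈ₚ-refl

  *ₚ-assoc : ∀ x y z → (x *ₚ y) *ₚ z ≈ₚ x *ₚ (y *ₚ z)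
  *ₚ-assoc []      y z = []≈[]
  *ₚ-assoc (a ∷ x) y z = begin
    (a ·ₚ y +ₚ X· (x *ₚ y)) *ₚ z          ≈⟨ *ₚ-distribʳ (a ·ₚ y) _ z ⟩
    (a ·ₚ y) *ₚ z +ₚ (X· (x *ₚ y)) *ₚ z   ≈⟨ +ₚ-cong (·ₚ-*ₚ a y z) (≈ₚ-trans (X·-*ₚ (x *ₚ y) z) (X·-cong (*ₚ-assoc x y z))) ⟩
    a ·ₚ (y *ₚ z) +ₚ X· (x *ₚ (y *ₚ z))   ∎
    where open ≈ₚ-Reasoning

  const-*ₚ : ∀ a y → const a *ₚ y ≈ₚ a ·ₚ y
  const-*ₚ a y = ≈ₚ-trans (+ₚ-congˡ (a ·ₚ y) X·-[]) (+ₚ-identityʳ _)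

  eval : Poly → Carrier → Carrier
  eval []      v = 0#
  eval (a ∷ x) v = a + v * eval x v

  eval-cong : ∀ {x y} → x ≈ₚ y → ∀ v → eval x v ≈ eval y v
  eval-cong []≈[]        v = refl
  eval-cong (∷≈[] a≈0 e) v = trans (+-cong a≈0 (*-congˡ (eval-cong e v))) (trans (+-identityˡ _) (zeroʳ v))
  eval-cong ([]≈∷ b≈0 e) v = sym (trans (+-cong b≈0 (*-congˡ (sym (eval-cong e v)))) (trans (+-identityˡ _) (zeroʳ v)))
  eval-cong (∷≈∷ a≈b e)  v = +-cong a≈b (*-congˡ (eval-cong e v))

  eval-congʳ : ∀ x {v w} → v ≈ w → eval x v ≈ eval x w
  eval-congʳ []      v≈w = refl
  eval-congʳ (a ∷ x) v≈w = +-congˡ (*-cong v≈w (eval-congʳ x v≈w))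

  eval-const : ∀ a v → eval (const a) v ≈ a
  eval-const a v = trans (+-congˡ (zeroʳ v)) (+-identityʳ a)

  eval-+ₚ : ∀ x y v → eval (x +ₚ y) v ≈ eval x v + eval y v
  eval-+ₚ []      y       v = sym (+-identityˡ _)
  eval-+ₚ (a ∷ x) []      v = sym (+-identityʳ _)
  eval-+ₚ (a ∷ x) (b ∷ y) v = begin
    (a + b) + v * eval (x +ₚ y) v             ≈⟨ +-congˡ (*-congˡ (eval-+ₚ x y v)) ⟩
    (a + b) + v * (eval x v + eval y v)
      ≈⟨ solve 5 (λ a b v x y → (a :+ b) :+ v :* (x :+ y) := (a :+ v :* x) :+ (b :+ v :* y))
               refl a b v (eval x v) (eval y v) ⟩
    (a + v * eval x v) + (b + v * eval y v)   ∎
    where open ≈-Reasoning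

  eval-·ₚ : ∀ a x v → eval (a ·ₚ x) v ≈ a * eval x v
  eval-·ₚ a []      v = sym (zeroʳ a)
  eval-·ₚ a (b ∷ x) v = begin
    a * b + v * eval (a ·ₚ x) v   ≈⟨ +-congˡ (*-congˡ (eval-·ₚ a x v)) ⟩
    a * b + v * (a * eval x v)    ≈⟨ solve 4 (λ a b v x → a :* b :+ v :* (a :* x) := a :* (b :+ v :* x)) refl a b v (eval x v) ⟩
    a * (b + v * eval x v)        ∎
    where open ≈-Reasoning

  eval-X· : ∀ x v → eval (X· x) v ≈ v * eval x v
  eval-X· x v = +-identityˡ _

  eval-*ₚ : ∀ x y v → eval (x *ₚ y) v ≈ eval x v * eval y v
  eval-*ₚ []      y v = sym (zeroˡ _)
  eval-*ₚ (a ∷ x) y v = begin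
    eval (a ·ₚ y +ₚ X· (x *ₚ y)) v           ≈⟨ eval-+ₚ (a ·ₚ y) _ v ⟩
    eval (a ·ₚ y) v + eval (X· (x *ₚ y)) v   ≈⟨ +-cong (eval-·ₚ a y v) (trans (eval-X· (x *ₚ y) v) (*-congˡ (eval-*ₚ x y v))) ⟩
    a * eval y v + v * (eval x v * eval y v) ≈⟨ solve 4 (λ a y v x → a :* y :+ v :* (x :* y) := (a :+ v :* x) :* y) refl a (eval y v) v (eval x v) ⟩
    (a + v * eval x v) * eval y v            ∎
    where open ≈-Reasoning

  eval--ₚ : ∀ x y v → eval (x -ₚ y) v ≈ eval x v - eval y v
  eval--ₚ x y v = trans (eval-+ₚ x (- 1# ·ₚ y) v) (+-congˡ (trans (eval-·ₚ (- 1#) y v) (-1*x≈-x _)))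

  eval-X^ : ∀ n v → eval (X^ n) v ≈ v ^ n
  eval-X^ zero    v = eval-const 1# v
  eval-X^ (suc n) v = trans (eval-X· (X^ n) v) (*-congˡ (eval-X^ n v))

  eval-X : ∀ v → eval X v ≈ v
  eval-X v = trans (eval-X^ 1 v) (*-identityʳ v)

  ∘ₚ-cong : ∀ {x y} h → x ≈ₚ y → x ∘ₚ h ≈ₚ y ∘ₚ h
  ∘ₚ-cong h []≈[]        = []≈[]
  ∘ₚ-cong h (∷≈[] a≈0 e) =
    +ₚ-cong (∷≈[] a≈0 []≈[]) (≈ₚ-trans (*ₚ-congʳ h (∘ₚ-cong h e)) (*ₚ-zeroʳ h))
  ∘ₚ-cong h ([]≈∷ b≈0 e) = ≈ₚ-sym
    (+ₚ-cong (∷≈[] b≈0 []≈[]) (≈ₚ-trans (*ₚ-congʳ h (≈ₚ-sym (∘ₚ-cong h e))) (*ₚ-zeroʳ h)))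
  ∘ₚ-cong h (∷≈∷ a≈b e)  = +ₚ-cong (∷≈∷ a≈b []≈[]) (*ₚ-congʳ h (∘ₚ-cong h e))

  ∘ₚ-+ₚ : ∀ x y h → (x +ₚ y) ∘ₚ h ≈ₚ x ∘ₚ h +ₚ y ∘ₚ h
  ∘ₚ-+ₚ []      y       h = ≈ₚ-refl
  ∘ₚ-+ₚ (a ∷ x) []      h = ≈ₚ-sym (+ₚ-identityʳ _)
  ∘ₚ-+ₚ (a ∷ x) (b ∷ y) h = begin
    const (a + b) +ₚ h *ₚ ((x +ₚ y) ∘ₚ h)
      ≈⟨ +ₚ-congˡ (const (a + b)) (≈ₚ-trans (*ₚ-congʳ h (∘ₚ-+ₚ x y h)) (*ₚ-distribˡ h _ _)) ⟩
    (const a +ₚ const b) +ₚ (h *ₚ (x ∘ₚ h) +ₚ h *ₚ (y ∘ₚ h))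
      ≈⟨ +ₚ-interchange (const a) (const b) (h *ₚ (x ∘ₚ h)) (h *ₚ (y ∘ₚ h)) ⟩
    (const a +ₚ h *ₚ (x ∘ₚ h)) +ₚ (const b +ₚ h *ₚ (y ∘ₚ h)) ∎
    where open ≈ₚ-Reasoning

  ∘ₚ-·ₚ : ∀ a x h → (a ·ₚ x) ∘ₚ h ≈ₚ a ·ₚ (x ∘ₚ h)
  ∘ₚ-·ₚ a []      h = []≈[]
  ∘ₚ-·ₚ a (b ∷ x) h = begin
    const (a * b) +ₚ h *ₚ ((a ·ₚ x) ∘ₚ h)  ≈⟨ +ₚ-congˡ (const (a * b)) (≈ₚ-trans (*ₚ-congʳ h (∘ₚ-·ₚ a x h)) (*ₚ-·ₚ h a _)) ⟩
    a ·ₚ const b +ₚ a ·ₚ (h *ₚ (x ∘ₚ h))   ≈⟨ ·ₚ-distribˡ a (const b) (h *ₚ (x ∘ₚ h)) ⟨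
    a ·ₚ (const b +ₚ h *ₚ (x ∘ₚ h))        ∎
    where open ≈ₚ-Reasoning

  ∘ₚ-*ₚ : ∀ x y h → (x *ₚ y) ∘ₚ h ≈ₚ (x ∘ₚ h) *ₚ (y ∘ₚ h)
  ∘ₚ-*ₚ []      y h = []≈[]
  ∘ₚ-*ₚ (a ∷ x) y h = begin
    (a ·ₚ y +ₚ X· (x *ₚ y)) ∘ₚ h
      ≈⟨ ∘ₚ-+ₚ (a ·ₚ y) _ h ⟩
    (a ·ₚ y) ∘ₚ h +ₚ (const 0# +ₚ h *ₚ ((x *ₚ y) ∘ₚ h))
      ≈⟨ +ₚ-cong (∘ₚ-·ₚ a y h) (+ₚ-cong (∷≈[] refl []≈[]) (*ₚ-congʳ h (∘ₚ-*ₚ x y h))) ⟩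
    a ·ₚ (y ∘ₚ h) +ₚ h *ₚ ((x ∘ₚ h) *ₚ (y ∘ₚ h))
      ≈⟨ +ₚ-cong (const-*ₚ a _) (*ₚ-assoc h _ _) ⟨
    const a *ₚ (y ∘ₚ h) +ₚ (h *ₚ (x ∘ₚ h)) *ₚ (y ∘ₚ h)
      ≈⟨ *ₚ-distribʳ (const a) (h *ₚ (x ∘ₚ h)) (y ∘ₚ h) ⟨
    (const a +ₚ h *ₚ (x ∘ₚ h)) *ₚ (y ∘ₚ h) ∎
    where open ≈ₚ-Reasoning

  eval-∘ₚ : ∀ x h v → eval (x ∘ₚ h) v ≈ eval x (eval h v)
  eval-∘ₚ []      h v = refl
  eval-∘ₚ (a ∷ x) h v = begin
    eval (const a +ₚ h *ₚ (x ∘ₚ h)) v        ≈⟨ eval-+ₚ (const a) (h *ₚ (x ∘ₚ h)) v ⟩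
    eval (const a) v + eval (h *ₚ (x ∘ₚ h)) v ≈⟨ +-cong (eval-const a v) (eval-*ₚ h (x ∘ₚ h) v) ⟩
    a + eval h v * eval (x ∘ₚ h) v           ≈⟨ +-congˡ (*-congˡ (eval-∘ₚ x h v)) ⟩
    a + eval h v * eval x (eval h v)         ∎
    where open ≈-Reasoning

  -- Degree bounds

  -- A record rather than a function so that x and n can be inferred from a proof.
  infix 4 deg_<_
  record deg_<_ (x : Poly) (n : ℕ) : Set ℓ where
    constructor deg<
    field coeff-vanishes : ∀ i → n ≤ℕ i → coeff x i ≈ 0#
  open deg_<_ public

  deg-cong : ∀ {n x y} → x ≈ₚ y → deg x < n → deg y < n
  deg-cong x≈y (deg< d) = deg< λ i n≤i → trans (sym (coeff-cong x≈y i)) (d i n≤i)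

  deg-mono : ∀ {m n x} → m ≤ℕ n → deg x < m → deg x < n
  deg-mono m≤n (deg< d) = deg< λ i n≤i → d i (ℕ.≤-trans m≤n n≤i)

  deg-+ₚ : ∀ {n x y} → deg x < n → deg y < n → deg x +ₚ y < n
  deg-+ₚ {x = x} {y} (deg< dx) (deg< dy) = deg< λ i n≤i →
    trans (coeff-+ₚ x y i) (trans (+-cong (dx i n≤i) (dy i n≤i)) (+-identityʳ 0#))

  deg-·ₚ : ∀ {n} a {x} → deg x < n → deg a ·ₚ x < n
  deg-·ₚ a {x} (deg< d) = deg< λ i n≤i → trans (coeff-·ₚ a x i) (trans (*-congˡ (d i n≤i)) (zeroʳ a))

  deg-∷ : ∀ {n} a {x} → deg x < n → deg a ∷ x < suc n
  deg-∷ a (deg< d) = deg< λ { (suc i) (s≤s n≤i) → d i n≤i }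

  deg-drop1 : ∀ {n} x → deg x < suc n → deg drop 1 x < n
  deg-drop1 []      _       = deg< λ _ _ → refl
  deg-drop1 (a ∷ x) (deg< d) = deg< λ i n≤i → d (suc i) (s≤s n≤i)

  deg-[] : ∀ {n} → deg [] < n
  deg-[] = deg< λ _ _ → refl

  deg-const : ∀ a → deg const a < 1
  deg-const a = deg-∷ a deg-[]

  deg-length : ∀ {n} x → length x ≤ℕ n → deg x < n
  deg-length []      _           = deg-[]
  deg-length (a ∷ x) (s≤s len≤n) = deg-∷ a (deg-length x len≤n)

  deg<0⇒≈[] : ∀ {x} → deg x < 0 → x ≈ₚ []
  deg<0⇒≈[] {x} (deg< d) = ≈ₚ-by-coeff x [] λ i → d i z≤n

  deg<⇒short : ∀ n x → deg x < n → Σ Poly λ y → x ≈ₚ y × length y ≤ℕ n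
  deg<⇒short zero    x       d        = [] , deg<0⇒≈[] d , z≤n
  deg<⇒short (suc n) []      _        = [] , []≈[] , z≤n
  deg<⇒short (suc n) (a ∷ x) (deg< d) with deg<⇒short n x (deg< λ i n≤i → d (suc i) (s≤s n≤i))
  ... | y , x≈y , len≤n = a ∷ y , ∷≈∷ refl x≈y , s≤s len≤n

  coeff-X^-≡ : ∀ n → coeff (X^ n) n ≈ 1#
  coeff-X^-≡ zero    = refl
  coeff-X^-≡ (suc n) = coeff-X^-≡ n

  coeff-X^-≢ : ∀ n i → i ≢ n → coeff (X^ n) i ≈ 0#
  coeff-X^-≢ zero    zero    i≢n = ⊥-elim (i≢n ≡.refl)
  coeff-X^-≢ zero    (suc i) i≢n = refl
  coeff-X^-≢ (suc n) zero    i≢n = refl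
  coeff-X^-≢ (suc n) (suc i) i≢n = coeff-X^-≢ n i (i≢n ∘ ≡.cong suc)

  deg-X^ : ∀ n → deg X^ n < suc n
  deg-X^ n = deg< λ i n<i → coeff-X^-≢ n i (λ i≡n → ℕ.<-irrefl (≡.sym i≡n) n<i)

  -- Translations and the difference operator

  infix 25 X+_
  X+_ : Carrier → Poly
  X+ w = w ∷ 1# ∷ []

  eval-X+ : ∀ w v → eval (X+ w) v ≈ w + v
  eval-X+ w v = +-congˡ (trans (*-congˡ (eval-const 1# v)) (*-identityʳ v))

  X+-*ₚ : ∀ w z → X+ w *ₚ z ≈ₚ w ·ₚ z +ₚ X· z
  X+-*ₚ w z = +ₚ-congˡ (w ·ₚ z) (X·-cong (≈ₚ-trans (const-*ₚ 1# z) (·ₚ-identityˡ z)))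

  Δ : Carrier → Poly → Poly
  Δ w t = t ∘ₚ X+ w -ₚ t

  Δ-cong : ∀ w {x y} → x ≈ₚ y → Δ w x ≈ₚ Δ w y
  Δ-cong w x≈y = +ₚ-cong (∘ₚ-cong (X+ w) x≈y) (·ₚ-cong refl x≈y)

  eval-Δ : ∀ w t v → eval (Δ w t) v ≈ eval t (w + v) - eval t v
  eval-Δ w t v = begin
    eval (Δ w t) v                       ≈⟨ eval--ₚ (t ∘ₚ X+ w) t v ⟩
    eval (t ∘ₚ X+ w) v - eval t v        ≈⟨ +-congʳ (eval-∘ₚ t (X+ w) v) ⟩
    eval t (eval (X+ w) v) - eval t v    ≈⟨ +-congʳ (eval-congʳ t (eval-X+ w v)) ⟩
    eval t (w + v) - eval t v            ∎
    where open ≈-Reasoning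

  Δ-∷ : ∀ w a x → Δ w (a ∷ x) ≈ₚ w ·ₚ (x ∘ₚ X+ w) +ₚ X· (Δ w x)
  Δ-∷ w a x = begin
    (const a +ₚ X+ w *ₚ U) -ₚ (a ∷ x)
      ≈⟨ +ₚ-cong (+ₚ-congˡ (const a) (X+-*ₚ w U)) (·ₚ-cong refl (∷≈∷ (sym (+-identityʳ a)) ≈ₚ-refl)) ⟩
    (const a +ₚ (w ·ₚ U +ₚ X· U)) -ₚ (const a +ₚ X· x)
      ≈⟨ +ₚ--ₚ-cancelˡ (const a) (w ·ₚ U) (X· U) (X· x) ⟩
    w ·ₚ U +ₚ (X· U -ₚ X· x)
      ≈⟨ +ₚ-congˡ (w ·ₚ U) (∷≈∷ (trans (+-congˡ (zeroʳ (- 1#))) (+-identityʳ 0#)) ≈ₚ-refl) ⟩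
    w ·ₚ U +ₚ X· (U -ₚ x) ∎
    where
    open ≈ₚ-Reasoning
    U = x ∘ₚ X+ w

  Δ-+ₚ : ∀ w x y → Δ w (x +ₚ y) ≈ₚ Δ w x +ₚ Δ w y
  Δ-+ₚ w x y = begin
    (x +ₚ y) ∘ₚ X+ w -ₚ (x +ₚ y)            ≈⟨ +ₚ-congʳ (-ₚ (x +ₚ y)) (∘ₚ-+ₚ x y (X+ w)) ⟩
    (x ∘ₚ X+ w +ₚ y ∘ₚ X+ w) -ₚ (x +ₚ y)    ≈⟨ -ₚ-interchange (x ∘ₚ X+ w) (y ∘ₚ X+ w) x y ⟩
    Δ w x +ₚ Δ w y                          ∎
    where open ≈ₚ-Reasoning

  Δ-*ₚ : ∀ {w h} x → h ∘ₚ X+ w ≈ₚ h → Δ w (x *ₚ h) ≈ₚ Δ w x *ₚ h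
  Δ-*ₚ {w} {h} x w-period = begin
    (x *ₚ h) ∘ₚ X+ w -ₚ x *ₚ h               ≈⟨ +ₚ-congʳ (-ₚ (x *ₚ h))
                                                  (≈ₚ-trans (∘ₚ-*ₚ x h (X+ w)) (*ₚ-congʳ (x ∘ₚ X+ w) w-period)) ⟩
    (x ∘ₚ X+ w) *ₚ h -ₚ x *ₚ h               ≈⟨ +ₚ-congˡ ((x ∘ₚ X+ w) *ₚ h) (·ₚ-*ₚ (- 1#) x h) ⟨
    (x ∘ₚ X+ w) *ₚ h +ₚ (-ₚ x) *ₚ h          ≈⟨ *ₚ-distribʳ (x ∘ₚ X+ w) (-ₚ x) h ⟨
    Δ w x *ₚ h                               ∎
    where open ≈ₚ-Reasoning

  eval-period : ∀ {w} x → x ∘ₚ X+ w ≈ₚ x → eval x w ≈ eval x 0#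
  eval-period {w} x w-period = begin
    eval x w                    ≈⟨ eval-congʳ x (+-identityʳ w) ⟨
    eval x (w + 0#)             ≈⟨ eval-congʳ x (eval-X+ w 0#) ⟨
    eval x (eval (X+ w) 0#)     ≈⟨ eval-∘ₚ x (X+ w) 0# ⟨
    eval (x ∘ₚ X+ w) 0#         ≈⟨ eval-cong w-period 0# ⟩
    eval x 0#                   ∎
    where open ≈-Reasoning

  deg-Δ : ∀ w {n t} → deg t < suc n → deg Δ w t < n
  deg-Δ w {n} {t} d with deg<⇒short (suc n) t d
  ... | y , t≈y , len = deg-cong (Δ-cong w (≈ₚ-sym t≈y)) (short n y len)
    where
    short : ∀ n t → length t ≤ℕ suc n → deg Δ w t < n
    short n       []       _         = deg-[]
    short zero    (_ ∷ _ ∷ _) (s≤s ())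
    short zero    (a ∷ []) _         =
      deg-cong (≈ₚ-sym (Δ-∷ w a [])) (deg-+ₚ (deg-·ₚ w deg-[]) (deg-cong (≈ₚ-sym X·-[]) deg-[]))
    short (suc n) (a ∷ x)  (s≤s len) =
      deg-cong (≈ₚ-sym (Δ-∷ w a x)) (deg-+ₚ (deg-·ₚ w deg-x∘X+) (deg-∷ 0# deg-Δx))
      where
      deg-Δx : deg Δ w x < n
      deg-Δx = short n x len
      deg-x∘X+ : deg x ∘ₚ X+ w < suc n
      deg-x∘X+ = deg-cong (-ₚ-+ₚ (x ∘ₚ X+ w) x) (deg-+ₚ (deg-mono (ℕ.n≤1+n n) deg-Δx) (deg-length x len))

  -- Counting roots

  -- The quotient of t by X - w, whose remainder is eval t w (see eval-deflate).
  deflate : Carrier → Poly → Poly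
  deflate w []                = []
  deflate w (c ∷ [])          = []
  deflate w (c ∷ t@(_ ∷ _))   = eval t w ∷ deflate w t

  deflate-length : ∀ w t {n} → length t ≤ℕ suc n → length (deflate w t) ≤ℕ n
  deflate-length w []            _         = z≤n
  deflate-length w (c ∷ [])      _         = z≤n
  deflate-length w (c ∷ t@(_ ∷ _)) {suc n} (s≤s len≤n) = s≤s (deflate-length w t len≤n)

  eval-deflate : ∀ w t v → eval t v ≈ eval t w + (v - w) * eval (deflate w t) v
  eval-deflate w []         v =
    solve 2 (λ v w → con (+ 0) := con (+ 0) :+ (v :- w) :* con (+ 0)) refl v w
  eval-deflate w (c ∷ [])   v =
    solve 3 (λ c v w → c :+ v :* con (+ 0) := (c :+ w :* con (+ 0)) :+ (v :- w) :* con (+ 0)) refl c v w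
  eval-deflate w (c ∷ t@(_ ∷ _)) v = begin
    c + v * eval t v
      ≈⟨ +-congˡ (*-congˡ (eval-deflate w t v)) ⟩
    c + v * (eval t w + (v - w) * eval (deflate w t) v)
      ≈⟨ solve 5 (λ c v w e q → c :+ v :* (e :+ (v :- w) :* q) := (c :+ w :* e) :+ (v :- w) :* (e :+ v :* q))
               refl c v w (eval t w) (eval (deflate w t) v) ⟩
    (c + w * eval t w) + (v - w) * (eval t w + v * eval (deflate w t) v) ∎
    where open ≈-Reasoning

  private
    head≈0 : ∀ {c w e} → e ≈ 0# → c + w * e ≈ 0# → c ≈ 0#
    head≈0 {c} {w} e≈0 c+we≈0 =
      trans (sym (trans (+-congˡ (trans (*-congˡ e≈0) (zeroʳ w))) (+-identityʳ c))) c+we≈0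

  deflate≈[]⇒≈[] : ∀ w t → deflate w t ≈ₚ [] → eval t w ≈ 0# → t ≈ₚ []
  deflate≈[]⇒≈[] w []              _                 _          = []≈[]
  deflate≈[]⇒≈[] w (c ∷ [])        _                 c+w0≈0     = ∷≈[] (head≈0 refl c+w0≈0) []≈[]
  deflate≈[]⇒≈[] w (c ∷ t@(_ ∷ _)) (∷≈[] t[w]≈0 q≈[]) c+wt[w]≈0 =
    ∷≈[] (head≈0 t[w]≈0 c+wt[w]≈0) (deflate≈[]⇒≈[] w t q≈[] t[w]≈0)

  module RootBound (*-cancelˡ-≉0 : ∀ {x y} → ¬ x ≈ 0# → x * y ≈ 0# → y ≈ 0#) where

    short-roots⇒≈[] : ∀ n (ρ : ℕ → Carrier) t →
                      (∀ {i j} → i <ℕ n → j <ℕ n → ρ i ≈ ρ j → i ≡ j) →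
                      (∀ {i} → i <ℕ n → eval t (ρ i) ≈ 0#) →
                      length t ≤ℕ n → t ≈ₚ []
    short-roots⇒≈[] zero    ρ []  _   _    _   = []≈[]
    short-roots⇒≈[] (suc n) ρ t   inj root len =
      deflate≈[]⇒≈[] w t
        (short-roots⇒≈[] n (ρ ∘ suc) (deflate w t) inj′ root′ (deflate-length w t len))
        (root (s≤s z≤n))
      where
      w = ρ 0
      inj′ : ∀ {i j} → i <ℕ n → j <ℕ n → ρ (suc i) ≈ ρ (suc j) → i ≡ j
      inj′ i<n j<n e = ℕ.suc-injective (inj (s≤s i<n) (s≤s j<n) e)
      root′ : ∀ {i} → i <ℕ n → eval (deflate w t) (ρ (suc i)) ≈ 0#
      root′ {i} i<n = *-cancelˡ-≉0 v-w≉0 (begin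
        (v - w) * eval (deflate w t) v          ≈⟨ +-identityˡ _ ⟨
        0# + (v - w) * eval (deflate w t) v     ≈⟨ +-congʳ (root (s≤s z≤n)) ⟨
        eval t w + (v - w) * eval (deflate w t) v ≈⟨ eval-deflate w t v ⟨
        eval t v                                 ≈⟨ root (s≤s i<n) ⟩
        0#                                       ∎)
        where
        open ≈-Reasoning
        v = ρ (suc i)
        v-w≉0 : ¬ v - w ≈ 0#
        v-w≉0 v-w≈0 with inj (s≤s i<n) (s≤s z≤n) (x∙y⁻¹≈ε⇒x≈y v w v-w≈0)
        ... | ()

    roots⇒≈[] : ∀ n (ρ : ℕ → Carrier) {t} →
                (∀ {i j} → i <ℕ n → j <ℕ n → ρ i ≈ ρ j → i ≡ j) →
                (∀ {i} → i <ℕ n → eval t (ρ i) ≈ 0#) →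
                deg t < n → t ≈ₚ []
    roots⇒≈[] n ρ {t} inj root d with deg<⇒short n t d
    ... | y , t≈y , len≤n = ≈ₚ-trans t≈y
      (short-roots⇒≈[] n ρ y inj (λ i<n → trans (sym (eval-cong t≈y _)) (root i<n)) len≤n)

  -- Division by a monic polynomial

  module MonicDivision (L : Poly) (m : ℕ) (L-monic : coeff L m ≈ 1#) (deg-L : deg L < suc m) where

    deg-reduce : ∀ t → deg t < suc m → deg t -ₚ coeff t m ·ₚ L < m
    deg-reduce t (deg< deg-t) = deg< reduced
      where
      open ≈-Reasoning
      e = coeff t m
      reduced : ∀ i → m ≤ℕ i → coeff (t -ₚ e ·ₚ L) i ≈ 0#
      reduced i m≤i with ℕ.m≤n⇒m<n∨m≡n m≤i
      ... | inj₁ m<i = begin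
        coeff (t -ₚ e ·ₚ L) i         ≈⟨ coeff--ₚ t (e ·ₚ L) i ⟩
        coeff t i - coeff (e ·ₚ L) i  ≈⟨ +-cong (deg-t i m<i) (-‿cong (coeff-vanishes (deg-·ₚ e deg-L) i m<i)) ⟩
        0# - 0#                       ≈⟨ -‿inverseʳ 0# ⟩
        0#                            ∎
      ... | inj₂ ≡.refl = begin
        coeff (t -ₚ e ·ₚ L) m         ≈⟨ coeff--ₚ t (e ·ₚ L) m ⟩
        e - coeff (e ·ₚ L) m          ≈⟨ +-congˡ (-‿cong (trans (coeff-·ₚ e L m) (trans (*-congˡ L-monic) (*-identityʳ e)))) ⟩
        e - e                         ≈⟨ -‿inverseʳ e ⟩
        0#                            ∎

    record Division (N : ℕ) (h : Poly) : Set (c ⊔ ℓ) where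
      field
        quotient remainder : Poly
        deg-quotient       : deg quotient < N
        deg-remainder      : deg remainder < m
        ≈remainder+quotient*L : h ≈ₚ remainder +ₚ quotient *ₚ L

    divide : ∀ N h → deg h < m +ℕ N → Division N h
    divide zero    h       deg-h = record
      { quotient = [] ; remainder = h ; deg-quotient = deg-[]
      ; deg-remainder = deg-mono (ℕ.≤-reflexive (ℕ.+-identityʳ m)) deg-h
      ; ≈remainder+quotient*L = ≈ₚ-sym (+ₚ-identityʳ h) }
    divide (suc N) []      _     = record
      { quotient = [] ; remainder = [] ; deg-quotient = deg-[] ; deg-remainder = deg-[]
      ; ≈remainder+quotient*L = []≈[] }
    divide (suc N) (c ∷ h) deg-h = record
      { quotient = e ∷ quotient ; remainder = t -ₚ e ·ₚ L
      ; deg-quotient = deg-∷ e deg-quotient ; deg-remainder = deg-reduce t (deg-∷ c deg-remainder)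
      ; ≈remainder+quotient*L = ≈ₚ-sym (begin
          (t -ₚ e ·ₚ L) +ₚ (e ·ₚ L +ₚ X· (quotient *ₚ L))  ≈⟨ -ₚ-+ₚ-cancel t (e ·ₚ L) (X· (quotient *ₚ L)) ⟩
          (c + 0#) ∷ (remainder +ₚ quotient *ₚ L)         ≈⟨ ∷≈∷ (+-identityʳ c) (≈ₚ-sym ≈remainder+quotient*L) ⟩
          c ∷ h                                           ∎) }
      where
      open ≈ₚ-Reasoning
      open Division (divide N h (deg-drop1 (c ∷ h) (deg-mono (ℕ.≤-reflexive (ℕ.+-suc m N)) deg-h)))
      t = c ∷ remainder
      e = coeff t m

    monic-cancel : ∀ q e → deg e < m → e +ₚ q *ₚ L ≈ₚ [] → q ≈ₚ [] × e ≈ₚ []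
    monic-cancel []      e _     e+0≈0    = []≈[] , ≈ₚ-trans (≈ₚ-sym (+ₚ-identityʳ e)) e+0≈0
    monic-cancel (c ∷ q) e deg-e e+cqL≈0 = ∷≈[] c≈0 (proj₁ IH) , e≈0
      where
      u = e +ₚ c ·ₚ L
      deg-u : deg u < suc m
      deg-u = deg-+ₚ (deg-mono (ℕ.n≤1+n m) deg-e) (deg-·ₚ c deg-L)
      u+XqL≈0 : u +ₚ X· (q *ₚ L) ≈ₚ []
      u+XqL≈0 = ≈ₚ-trans (+ₚ-assoc e (c ·ₚ L) _) e+cqL≈0
      u≈Xu′ : u ≈ₚ X· (drop 1 u)
      u≈Xu′ = X·-drop1 u (trans (sym (+-identityʳ _)) (trans (sym (coeff-+ₚ u _ 0)) (coeff-cong u+XqL≈0 0)))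
      u′+qL≈0 : drop 1 u +ₚ q *ₚ L ≈ₚ []
      u′+qL≈0 = X·-injective (≈ₚ-trans (X·-+ₚ (drop 1 u) _) (≈ₚ-trans (+ₚ-congʳ _ (≈ₚ-sym u≈Xu′)) u+XqL≈0))
      IH = monic-cancel q (drop 1 u) (deg-drop1 u deg-u) u′+qL≈0
      u≈0 : u ≈ₚ []
      u≈0 = ≈ₚ-trans u≈Xu′ (≈ₚ-trans (X·-cong (proj₂ IH)) X·-[])
      c≈0 : c ≈ 0#
      c≈0 = begin
        c                              ≈⟨ trans (+-identityˡ (c * 1#)) (*-identityʳ c) ⟨
        0# + c * 1#                    ≈⟨ +-cong (coeff-vanishes deg-e m ℕ.≤-refl) (*-congˡ L-monic) ⟨
        coeff e m + c * coeff L m      ≈⟨ +-congˡ (coeff-·ₚ c L m) ⟨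
        coeff e m + coeff (c ·ₚ L) m   ≈⟨ coeff-+ₚ e _ m ⟨
        coeff u m                      ≈⟨ coeff-cong u≈0 m ⟩
        0#                             ∎
        where open ≈-Reasoning
      e≈0 : e ≈ₚ []
      e≈0 = ≈ₚ-trans (≈ₚ-sym (≈ₚ-trans (+ₚ-congˡ e (·ₚ-zeroˡ L c≈0)) (+ₚ-identityʳ e))) u≈0

module _ {p} (p-prime : Prime p) where

  private
    instance
      p≢0 : ℕ.NonZero p
      p≢0 = prime⇒nonZero p-prime

  prime∤! : ∀ j → j <ℕ p → ¬ p ∣ j !
  prime∤! zero    _   p∣1 = ℕ.<-irrefl (≡.sym (∣1⇒≡1 p∣1))
    (ℕ.nonTrivial⇒n>1 p {{prime⇒nonTrivial p-prime}})
  prime∤! (suc j) j<p p∣j! with euclidsLemma (suc j) (j !) p-prime p∣j!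
  ... | inj₁ p∣1+j = ℕ.<⇒≱ j<p (∣⇒≤ p∣1+j)
  ... | inj₂ p∣j!  = prime∤! j (ℕ.<-trans (ℕ.n<1+n j) j<p) p∣j!

  prime∣C : ∀ {k} → 0 <ℕ k → k <ℕ p → p ∣ p C k
  prime∣C {k} 0<k k<p with euclidsLemma (p C k) (k ! *ℕ (p ∸ k) !) p-prime (p∣C*k![p-k]! (ℕ.<⇒≤ k<p))
    where
    p∣C*k![p-k]! : k ≤ℕ p → p ∣ (p C k) *ℕ (k ! *ℕ (p ∸ k) !)
    p∣C*k![p-k]! k≤p = ≡.subst (p ∣_)
      (≡.sym (≡.trans (≡.cong (_*ℕ (k ! *ℕ (p ∸ k) !)) (nCk≡n!/k![n-k]! k≤p)) (m/n*n≡m {{_}} (k![n∸k]!∣n! k≤p))))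
      (≡.subst (λ n → n ∣ n !) (ℕ.suc-pred p) (m∣m*n (ℕ.pred p !)))
  ... | inj₁ p∣C = p∣C
  ... | inj₂ p∣k![p-k]! with euclidsLemma (k !) ((p ∸ k) !) p-prime p∣k![p-k]!
  ...   | inj₁ p∣k!     = ⊥-elim (prime∤! k k<p p∣k!)
  ...   | inj₂ p∣[p-k]! = ⊥-elim (prime∤! (p ∸ k) (ℕ.∸-monoʳ-< 0<k (ℕ.<⇒≤ k<p)) p∣[p-k]!)

module Characteristic {c ℓ} (R : CommutativeRing c ℓ) {p : ℕ}
                      (char-p : FieldOps.HasCharacteristic R p) where

  open CommutativeRing R
  open FieldOps R
  open import Algebra.Properties.Ring ring using (-‿involutive; +-inverseˡ-unique)
  open SetoidReasoning setoid

  p-prime : Prime p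
  p-prime = proj₁ char-p

  private
    instance
      p≢0 : ℕ.NonZero p
      p≢0 = prime⇒nonZero p-prime

  1<p : 1 <ℕ p
  1<p = ℕ.nonTrivial⇒n>1 p {{prime⇒nonTrivial p-prime}}

  •-cong : ∀ n {x y} → x ≈ y → n • x ≈ n • y
  •-cong zero    _   = refl
  •-cong (suc n) x≈y = +-cong x≈y (•-cong n x≈y)

  •-+ : ∀ m n x → (m +ℕ n) • x ≈ m • x + n • x
  •-+ zero    n x = sym (+-identityˡ _)
  •-+ (suc m) n x = trans (+-congˡ (•-+ m n x)) (sym (+-assoc _ _ _))

  •-* : ∀ m n x → (m *ℕ n) • x ≈ m • (n • x)
  •-* zero    n x = refl
  •-* (suc m) n x = trans (•-+ n (m *ℕ n) x) (+-congˡ (•-* m n x))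

  •-0 : ∀ n → n • 0# ≈ 0#
  •-0 zero    = refl
  •-0 (suc n) = trans (+-identityˡ _) (•-0 n)

  •≈•1* : ∀ n x → n • x ≈ (n • 1#) * x
  •≈•1* zero    x = sym (zeroˡ x)
  •≈•1* (suc n) x = begin
    x + n • x                 ≈⟨ +-cong (*-identityˡ x) (sym (•≈•1* n x)) ⟨
    1# * x + (n • 1#) * x     ≈⟨ distribʳ x 1# (n • 1#) ⟨
    (1# + n • 1#) * x         ∎

  *p•≈0 : ∀ k x → (k *ℕ p) • x ≈ 0#
  *p•≈0 k x = begin
    (k *ℕ p) • x       ≈⟨ •-* k p x ⟩
    k • (p • x)        ≈⟨ •-cong k (•≈•1* p x) ⟩
    k • ((p • 1#) * x) ≈⟨ •-cong k (trans (*-congʳ (proj₂ char-p)) (zeroˡ x)) ⟩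
    k • 0#             ≈⟨ •-0 k ⟩
    0#                 ∎

  p∸1•≈- : ∀ x → (p ∸ 1) • x ≈ - x
  p∸1•≈- x = +-inverseˡ-unique _ _ (begin
    (p ∸ 1) • x + x  ≈⟨ +-comm _ x ⟩
    suc (p ∸ 1) • x  ≡⟨ ≡.cong (_• x) (≡.trans (ℕ.suc-pred p) (≡.sym (ℕ.*-identityˡ p))) ⟩
    (1 *ℕ p) • x     ≈⟨ *p•≈0 1 x ⟩
    0#               ∎)

  •-invertible : ∀ {δ} → 0 <ℕ δ → δ <ℕ p → Σ ℕ λ u → ∀ x → u • (δ • x) ≈ x
  •-invertible {δ@(suc _)} _ δ<p with coprime-Bézout (prime⇒coprime p-prime δ<p)
  ... | Bézout.+- k u 1+uδ≡kp = (p ∸ 1) *ℕ u , λ x → begin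
    ((p ∸ 1) *ℕ u) • (δ • x)  ≈⟨ •-* (p ∸ 1) u (δ • x) ⟩
    (p ∸ 1) • (u • (δ • x))   ≈⟨ •-cong (p ∸ 1) (•-* u δ x) ⟨
    (p ∸ 1) • ((u *ℕ δ) • x)  ≈⟨ •-cong (p ∸ 1) (uδ•≈- x) ⟩
    (p ∸ 1) • (- x)           ≈⟨ p∸1•≈- (- x) ⟩
    - - x                     ≈⟨ -‿involutive x ⟩
    x                         ∎
    where
    uδ•≈- : ∀ x → (u *ℕ δ) • x ≈ - x
    uδ•≈- x = +-inverseˡ-unique _ _ (begin
      (u *ℕ δ) • x + x      ≈⟨ +-comm _ x ⟩
      (1 +ℕ u *ℕ δ) • x     ≡⟨ ≡.cong (_• x) 1+uδ≡kp ⟩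
      (k *ℕ p) • x          ≈⟨ *p•≈0 k x ⟩
      0#                    ∎)
  ... | Bézout.-+ k u 1+kp≡uδ = u , λ x → begin
    u • (δ • x)           ≈⟨ •-* u δ x ⟨
    (u *ℕ δ) • x          ≡⟨ ≡.cong (_• x) 1+kp≡uδ ⟨
    x + (k *ℕ p) • x      ≈⟨ +-congˡ (*p•≈0 k x) ⟩
    x + 0#                ≈⟨ +-identityʳ x ⟩
    x                     ∎

  •-cancel : ∀ {δ x} → 0 <ℕ δ → δ <ℕ p → δ • x ≈ 0# → x ≈ 0#
  •-cancel {δ} {x} 0<δ δ<p δx≈0 with •-invertible 0<δ δ<p
  ... | u , u•δ•≈id = trans (sym (u•δ•≈id x)) (trans (•-cong u δx≈0) (•-0 u))

  -‿•≈ : ∀ n x → - (n • x) ≈ ((p ∸ 1) *ℕ n) • x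
  -‿•≈ n x = sym (trans (•-* (p ∸ 1) n x) (p∸1•≈- (n • x)))

  ^-cong : ∀ n {x y} → x ≈ y → x ^ n ≈ y ^ n
  ^-cong zero    _   = refl
  ^-cong (suc n) x≈y = *-cong x≈y (^-cong n x≈y)

  ^-+ : ∀ x m n → x ^ (m +ℕ n) ≈ x ^ m * x ^ n
  ^-+ x zero    n = sym (*-identityˡ _)
  ^-+ x (suc m) n = trans (*-congˡ (^-+ x m n)) (sym (*-assoc _ _ _))

  ^-* : ∀ x m n → x ^ (m *ℕ n) ≈ (x ^ n) ^ m
  ^-* x zero    n = refl
  ^-* x (suc m) n = trans (^-+ x n (m *ℕ n)) (*-congˡ (^-* x m n))

  1^ : ∀ n → 1# ^ n ≈ 1#
  1^ zero    = refl
  1^ (suc n) = trans (*-identityˡ _) (1^ n)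

  module _ where
    open import Algebra.Properties.CommutativeSemiring.Binomial commutativeSemiring
      using (theorem; binomialTerm)
    open import Algebra.Properties.Semiring.Mult semiring using () renaming (_×_ to _×ᴹ_)
    open import Algebra.Properties.Semiring.Exp semiring using () renaming (_^_ to _^ᴹ_)
    open import Algebra.Properties.Monoid.Sum +-monoid using (sum; sum-init-last; sum-cong-≋; sum-replicate-zero)

    private
      ×ᴹ≈• : ∀ n x → n ×ᴹ x ≈ n • x
      ×ᴹ≈• zero    x = refl
      ×ᴹ≈• (suc n) x = +-congˡ (×ᴹ≈• n x)

      ^ᴹ≈^ : ∀ x n → x ^ᴹ n ≈ x ^ n
      ^ᴹ≈^ x zero    = refl
      ^ᴹ≈^ x (suc n) = *-congˡ (^ᴹ≈^ x n)

      sum-first-last : ∀ q (t : Vector Carrier (suc (suc q))) →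
                       (∀ (k : Fin q) → t (Fin.suc (inject₁ k)) ≈ 0#) →
                       sum t ≈ t Fin.zero + t (fromℕ (suc q))
      sum-first-last q t interior≈0 = +-congˡ (begin
        sum (t ∘ Fin.suc)                              ≈⟨ sum-init-last (t ∘ Fin.suc) ⟩
        sum (t ∘ Fin.suc ∘ inject₁) + t (fromℕ (suc q)) ≈⟨ +-congʳ (trans (sum-cong-≋ interior≈0) (sum-replicate-zero q)) ⟩
        0# + t (fromℕ (suc q))                         ≈⟨ +-identityˡ _ ⟩
        t (fromℕ (suc q))                              ∎)

    freshmansDream : ∀ q x y → (∀ {k} → 0 <ℕ k → k ≤ℕ q → ∀ z → (suc q C k) • z ≈ 0#) →
                     (x + y) ^ suc q ≈ x ^ suc q + y ^ suc q
    freshmansDream q x y C•≈0 = begin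
      (x + y) ^ n                                   ≈⟨ ^ᴹ≈^ (x + y) n ⟨
      (x + y) ^ᴹ n                                  ≈⟨ theorem n x y ⟩
      sum (binomialTerm x y n)                      ≈⟨ sum-first-last q (binomialTerm x y n) interior≈0 ⟩
      binomialTerm x y n Fin.zero + binomialTerm x y n (fromℕ n)
        ≈⟨ +-cong first (last (toℕ (fromℕ n)) (Fin.toℕ-fromℕ n)) ⟩
      y ^ᴹ n + x ^ᴹ n                               ≈⟨ +-comm _ _ ⟩
      x ^ᴹ n + y ^ᴹ n                               ≈⟨ +-cong (^ᴹ≈^ x n) (^ᴹ≈^ y n) ⟩
      x ^ n + y ^ n                                 ∎
      where
      n = suc q
      interior≈0 : ∀ (k : Fin q) → binomialTerm x y n (Fin.suc (inject₁ k)) ≈ 0#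
      interior≈0 k = trans (×ᴹ≈• (n C suc (toℕ (inject₁ k))) _) (C•≈0 (s≤s z≤n)
        (≡.subst (_≤ℕ q) (≡.cong suc (≡.sym (Fin.toℕ-inject₁ k))) (Fin.toℕ<n k)) _)
      first : binomialTerm x y n Fin.zero ≈ y ^ᴹ n
      first = trans (+-identityʳ _) (*-identityˡ _)
      last : ∀ j → j ≡ n → (n C j) ×ᴹ (x ^ᴹ j * y ^ᴹ (n ∸ j)) ≈ x ^ᴹ n
      last j ≡.refl rewrite nCn≡1 n | ℕ.n∸n≡0 n = trans (+-identityʳ _) (*-identityʳ _)

  frobenius-+ : ∀ x y → (x + y) ^ p ≈ x ^ p + y ^ p
  frobenius-+ x y = ≡.subst (λ n → (x + y) ^ n ≈ x ^ n + y ^ n) (ℕ.suc-pred p)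
    (freshmansDream (ℕ.pred p) x y C•≈0)
    where
    C•≈0 : ∀ {k} → 0 <ℕ k → k ≤ℕ ℕ.pred p → ∀ z → (suc (ℕ.pred p) C k) • z ≈ 0#
    C•≈0 {k} 0<k k≤p-1 z with prime∣C p-prime 0<k (≡.subst (k <ℕ_) (ℕ.suc-pred p) (s≤s k≤p-1))
    ... | divides d pCk≡dp = ≡.subst (λ n → (n C k) • z ≈ 0#) (≡.sym (ℕ.suc-pred p))
                               (trans (reflexive (≡.cong (_• z) pCk≡dp)) (*p•≈0 d z))

module _ {c ℓ} (R : CommutativeRing c ℓ) where

  open CommutativeRing R
  open FieldOps R using (_•_)
  open import Algebra.Properties.Ring ring using (+-inverseˡ-unique)
  open import Algebra.Properties.AbelianGroup +-abelianGroup using (identityʳ-unique)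

  module AdditiveMap (f : Carrier → Carrier) (f-cong : ∀ {x y} → x ≈ y → f x ≈ f y)
                     (f-+ : ∀ x y → f (x + y) ≈ f x + f y) where

    f-0 : f 0# ≈ 0#
    f-0 = identityʳ-unique (f 0#) (f 0#) (trans (sym (f-+ 0# 0#)) (f-cong (+-identityʳ 0#)))

    f-‿ : ∀ x → f (- x) ≈ - f x
    f-‿ x = +-inverseˡ-unique _ _ (trans (sym (f-+ (- x) x)) (trans (f-cong (-‿inverseˡ x)) f-0))

    f-• : ∀ n x → f (n • x) ≈ n • f x
    f-• zero    x = f-0
    f-• (suc n) x = trans (f-+ x (n • x)) (+-congˡ (f-• n x))

module PrimeSubfieldPlane {c ℓ} (F : CommutativeRing c ℓ) (F-field : IsFieldCR F) {p : ℕ}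
                          (char-p : FieldOps.HasCharacteristic F p)
                          (a : CommutativeRing.Carrier F) (a∉𝔽ₚ : ¬ FieldOps.InPrimeField F a) where

  open CommutativeRing F
  open FieldOps F
  open Characteristic F char-p
  open IntegerRingSolver F using (solve; _:=_; _:+_; _:*_; _:-_)
  open SetoidReasoning setoid
  open import Algebra.Properties.Ring ring using (+-cancelʳ)

  private
    instance
      p≢0 : ℕ.NonZero p
      p≢0 = prime⇒nonZero p-prime

  point : ℕ → ℕ → Carrier
  point i j = i • 1# + j • a

  private
    shift-cancel : ∀ i i′ j δ → point i j ≈ point i′ (j +ℕ δ) → i • 1# ≈ i′ • 1# + δ • a
    shift-cancel i i′ j δ ij≈i′j+δ = +-cancelʳ (j • a) _ _ (begin
      i • 1# + j • a                 ≈⟨ ij≈i′j+δ ⟩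
      i′ • 1# + (j +ℕ δ) • a         ≈⟨ +-congˡ (trans (•-+ j δ a) (+-comm _ _)) ⟩
      i′ • 1# + (δ • a + j • a)      ≈⟨ +-assoc _ _ _ ⟨
      (i′ • 1# + δ • a) + j • a      ∎)

    •1-injective-≤ : ∀ {i i′} → i ≤ℕ i′ → i′ <ℕ p → i • 1# ≈ i′ • 1# → i ≡ i′
    •1-injective-≤ {i} i≤i′ i′<p i≈i′ with ℕ.≤⇒≤″ i≤i′
    ... | zero  , ≡.refl = ≡.sym (ℕ.+-identityʳ i)
    ... | suc δ , ≡.refl = ⊥-elim (IsFieldCR.1≉0 F-field (•-cancel (s≤s z≤n) δ<p δ•1≈0))
      where
      δ<p : suc δ <ℕ p
      δ<p = ℕ.≤-<-trans (ℕ.m≤n+m (suc δ) i) i′<p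
      δ•1≈0 : suc δ • 1# ≈ 0#
      δ•1≈0 = sym (+-cancelʳ (i • 1#) _ _ (begin
        0# + i • 1#               ≈⟨ +-identityˡ _ ⟩
        i • 1#                    ≈⟨ i≈i′ ⟩
        (i +ℕ suc δ) • 1#         ≈⟨ •-+ i (suc δ) 1# ⟩
        i • 1# + suc δ • 1#       ≈⟨ +-comm _ _ ⟩
        suc δ • 1# + i • 1#       ∎))

  •1-injective : ∀ {i i′} → i <ℕ p → i′ <ℕ p → i • 1# ≈ i′ • 1# → i ≡ i′
  •1-injective i<p i′<p i≈i′ with ℕ.≤-total _ _
  ... | inj₁ i≤i′ = •1-injective-≤ i≤i′ i′<p i≈i′
  ... | inj₂ i′≤i = ≡.sym (•1-injective-≤ i′≤i i<p (sym i≈i′))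

  ∉𝔽ₚ-offset : ∀ i i′ {δ} → 0 <ℕ δ → δ <ℕ p → ¬ i • 1# ≈ i′ • 1# + δ • a
  ∉𝔽ₚ-offset i i′ {δ} 0<δ δ<p i≈i′+δa with •-invertible 0<δ δ<p
  ... | u , u•δ•≈id = a∉𝔽ₚ (u *ℕ n , (begin
    a              ≈⟨ u•δ•≈id a ⟨
    u • (δ • a)    ≈⟨ •-cong u δa≈n ⟩
    u • (n • 1#)   ≈⟨ •-* u n 1# ⟨
    (u *ℕ n) • 1#  ∎))
    where
    n = i +ℕ (p ∸ 1) *ℕ i′
    δa≈n : δ • a ≈ n • 1#
    δa≈n = begin
      δ • a                            ≈⟨ solve 2 (λ x y → y := (x :+ y) :- x) refl (i′ • 1#) (δ • a) ⟩
      (i′ • 1# + δ • a) - i′ • 1#      ≈⟨ +-cong (sym i≈i′+δa) (-‿•≈ i′ 1#) ⟩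
      i • 1# + ((p ∸ 1) *ℕ i′) • 1#    ≈⟨ •-+ i _ 1# ⟨
      n • 1#                           ∎

  private
    point-injective-≤ : ∀ {i i′ j j′} → i <ℕ p → i′ <ℕ p → j′ <ℕ p → j ≤ℕ j′ →
                        point i j ≈ point i′ j′ → i ≡ i′ × j ≡ j′
    point-injective-≤ {i} {i′} {j} i<p i′<p j′<p j≤j′ ij≈i′j′ with ℕ.≤⇒≤″ j≤j′
    ... | zero  , ≡.refl =
      •1-injective i<p i′<p (trans (shift-cancel i i′ j 0 ij≈i′j′) (+-identityʳ _)) , ≡.sym (ℕ.+-identityʳ j)
    ... | suc δ , ≡.refl = ⊥-elim (∉𝔽ₚ-offset i i′ (s≤s z≤n) (ℕ.≤-<-trans (ℕ.m≤n+m (suc δ) j) j′<p)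
                                                (shift-cancel i i′ j (suc δ) ij≈i′j′))

  point-injective : ∀ {i i′ j j′} → i <ℕ p → i′ <ℕ p → j <ℕ p → j′ <ℕ p →
                    point i j ≈ point i′ j′ → i ≡ i′ × j ≡ j′
  point-injective i<p i′<p j<p j′<p ij≈i′j′ with ℕ.≤-total _ _
  ... | inj₁ j≤j′ = point-injective-≤ i<p i′<p j′<p j≤j′ ij≈i′j′
  ... | inj₂ j′≤j with point-injective-≤ i′<p i<p j<p j′≤j (sym ij≈i′j′)
  ...   | i′≡i , j′≡j = ≡.sym i′≡i , ≡.sym j′≡j

  W : Carrier → Set ℓ
  W v = ∃₂ λ i j → v ≈ point i j

  W-+ : ∀ {v w} → W v → W w → W (v + w)
  W-+ (i , j , v≈ij) (i′ , j′ , w≈i′j′) = i +ℕ i′ , j +ℕ j′ , (begin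
    _ + _                                  ≈⟨ +-cong v≈ij w≈i′j′ ⟩
    (i • 1# + j • a) + (i′ • 1# + j′ • a)  ≈⟨ +-interchange _ _ _ _ ⟩
    (i • 1# + i′ • 1#) + (j • a + j′ • a)  ≈⟨ +-cong (•-+ i i′ 1#) (•-+ j j′ a) ⟨
    point (i +ℕ i′) (j +ℕ j′)              ∎)
    where open import Algebra.Properties.CommutativeSemigroup +-commutativeSemigroup
            using () renaming (interchange to +-interchange)

  W⊆ : ∀ {ℓ′} {S : Carrier → Set ℓ′} → IsPrimeSubspace S → S 1# → S a → ∀ {v} → W v → S v
  W⊆ S-subspace S∋1 S∋a (i , j , v≈ij) =
    respects (sym v≈ij) (+-closed (•-closed i S∋1) (•-closed j S∋a))
    where open IsPrimeSubspace S-subspace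

  enumerate : ℕ → Carrier
  enumerate k = point (k % p) (k / p)

  enumerate∈W : ∀ k → W (enumerate k)
  enumerate∈W k = k % p , k / p , refl

  private
    /p<p : ∀ {k} → k <ℕ p *ℕ p → k / p <ℕ p
    /p<p {k} k<p² = ℕ.*-cancelʳ-< p _ _ (ℕ.≤-<-trans (m/n*n≤m k p) k<p²)

  enumerate-injective : ∀ {k k′} → k <ℕ p *ℕ p → k′ <ℕ p *ℕ p → enumerate k ≈ enumerate k′ → k ≡ k′
  enumerate-injective {k} {k′} k<p² k′<p² e
    with point-injective (m%n<n k p) (m%n<n k′ p) (/p<p k<p²) (/p<p k′<p²) e
  ... | k%p≡k′%p , k/p≡k′/p = ≡.trans (m≡m%n+[m/n]*n k p)
    (≡.trans (≡.cong₂ (λ r q → r +ℕ q *ℕ p) k%p≡k′%p k/p≡k′/p) (≡.sym (m≡m%n+[m/n]*n k′ p)))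

  φ : Carrier → Carrier
  φ x = x ^ p

  open AdditiveMap F φ (^-cong p) frobenius-+ using () renaming (f-‿ to φ-‿)

  β : Carrier
  β = (a - a ^ p) ^ (p ∸ 1)

  𝓛 : Carrier → Carrier
  𝓛 v = (φ (φ v) - (1# + β) * φ v) + β * v

  𝓛-cong : ∀ {x y} → x ≈ y → 𝓛 x ≈ 𝓛 y
  𝓛-cong x≈y = +-cong (+-cong (^-cong p (^-cong p x≈y)) (-‿cong (*-congˡ (^-cong p x≈y)))) (*-congˡ x≈y)

  𝓛-+ : ∀ x y → 𝓛 (x + y) ≈ 𝓛 x + 𝓛 y
  𝓛-+ x y = begin
    (φ (φ (x + y)) - (1# + β) * φ (x + y)) + β * (x + y)
      ≈⟨ +-congʳ (+-cong (trans (^-cong p (frobenius-+ x y)) (frobenius-+ (φ x) (φ y))) (-‿cong (*-congˡ (frobenius-+ x y)))) ⟩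
    ((φ (φ x) + φ (φ y)) - (1# + β) * (φ x + φ y)) + β * (x + y)
      ≈⟨ solve 8 (λ A A′ B B′ o c x y → ((A :+ A′) :- (o :+ c) :* (B :+ B′)) :+ c :* (x :+ y)
                   := ((A :- (o :+ c) :* B) :+ c :* x) :+ ((A′ :- (o :+ c) :* B′) :+ c :* y))
                 refl (φ (φ x)) (φ (φ y)) (φ x) (φ y) 1# β x y ⟩
    𝓛 x + 𝓛 y ∎

  𝓛-1 : 𝓛 1# ≈ 0#
  𝓛-1 = begin
    (φ (φ 1#) - (1# + β) * φ 1#) + β * 1#  ≈⟨ +-cong (+-cong φφ1≈1 (-‿cong (trans (*-congˡ (1^ p)) (*-identityʳ _)))) (*-identityʳ β) ⟩
    (1# - (1# + β)) + β                   ≈⟨ solve 2 (λ o c → (o :- (o :+ c)) :+ c := (o :- o)) refl 1# β ⟩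
    1# - 1#                               ≈⟨ -‿inverseʳ 1# ⟩
    0#                                    ∎
    where
    φφ1≈1 : φ (φ 1#) ≈ 1#
    φφ1≈1 = trans (^-cong p (1^ p)) (1^ p)

  -- β · D = D ^ p = φ D for D = a - φ a; this is what makes a a root.
  𝓛-a : 𝓛 a ≈ 0#
  𝓛-a = begin
    (φ (φ a) - (1# + β) * φ a) + β * a
      ≈⟨ solve 5 (λ A B o c a → (A :- (o :+ c) :* B) :+ c :* a := (A :- o :* B) :+ c :* (a :- B)) refl (φ (φ a)) (φ a) 1# β a ⟩
    (φ (φ a) - 1# * φ a) + β * D
      ≈⟨ +-cong (+-congˡ (-‿cong (*-identityˡ _))) βD≈φD ⟩
    (φ (φ a) - φ a) + φ D
      ≈⟨ +-congˡ (trans (frobenius-+ a (- φ a)) (+-congˡ (φ-‿ (φ a)))) ⟩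
    (φ (φ a) - φ a) + (φ a - φ (φ a))
      ≈⟨ solve 2 (λ A B → (A :- B) :+ (B :- A) := A :- A) refl (φ (φ a)) (φ a) ⟩
    φ (φ a) - φ (φ a)
      ≈⟨ -‿inverseʳ _ ⟩
    0# ∎
    where
    D = a - φ a
    βD≈φD : β * D ≈ φ D
    βD≈φD = trans (*-comm β D) (≡.subst (λ n → D * β ≈ D ^ n) (ℕ.suc-pred p) refl)

  open AdditiveMap F 𝓛 𝓛-cong 𝓛-+ using () renaming (f-• to 𝓛-•)

  𝓛-W : ∀ {v} → W v → 𝓛 v ≈ 0#
  𝓛-W {v} (i , j , v≈ij) = begin
    𝓛 v                     ≈⟨ trans (𝓛-cong v≈ij) (𝓛-+ (i • 1#) (j • a)) ⟩
    𝓛 (i • 1#) + 𝓛 (j • a)  ≈⟨ +-cong (𝓛-• i 1#) (𝓛-• j a) ⟩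
    i • 𝓛 1# + j • 𝓛 a      ≈⟨ +-cong (trans (•-cong i 𝓛-1) (•-0 i)) (trans (•-cong j 𝓛-a) (•-0 j)) ⟩
    0# + 0#                 ≈⟨ +-identityʳ 0# ⟩
    0#                      ∎

module SubspacePolynomial {c ℓ} (F : CommutativeRing c ℓ) (F-field : IsFieldCR F) {p : ℕ}
                          (char-p : FieldOps.HasCharacteristic F p)
                          (a : CommutativeRing.Carrier F) (a∉𝔽ₚ : ¬ FieldOps.InPrimeField F a) where

  open CommutativeRing F
  open FieldOps F
  open Characteristic F char-p
  open PrimeSubfieldPlane F F-field char-p a a∉𝔽ₚ
  open IntegerRingSolver F using (solve; _:=_; _:+_; _:*_; _:-_; con)
  open Polynomials F

  p² : ℕ
  p² = p *ℕ p

  L : Poly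
  L = (X^ p² -ₚ (1# + β) ·ₚ X^ p) +ₚ β ·ₚ X

  eval-L : ∀ v → eval L v ≈ 𝓛 v
  eval-L v = begin
    eval L v
      ≈⟨ eval-+ₚ (X^ p² -ₚ (1# + β) ·ₚ X^ p) (β ·ₚ X) v ⟩
    eval (X^ p² -ₚ (1# + β) ·ₚ X^ p) v + eval (β ·ₚ X) v
      ≈⟨ +-cong (eval--ₚ (X^ p²) ((1# + β) ·ₚ X^ p) v) (eval-·ₚ β X v) ⟩
    (eval (X^ p²) v - eval ((1# + β) ·ₚ X^ p) v) + β * eval X v
      ≈⟨ +-cong (+-cong (trans (eval-X^ p² v) (^-* v p p))
                        (-‿cong (trans (eval-·ₚ (1# + β) (X^ p) v) (*-congˡ (eval-X^ p v)))))
                (*-congˡ (eval-X v)) ⟩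
    𝓛 v ∎
    where open ≈-Reasoning

  private
    p<p² : p <ℕ p²
    p<p² = ℕ.m<m*n p p {{prime⇒nonZero p-prime}} 1<p

    2≤p² : 2 ≤ℕ p²
    2≤p² = ℕ.≤-trans 1<p (ℕ.<⇒≤ p<p²)

    1≤p² : 1 ≤ℕ p²
    1≤p² = ℕ.≤-trans (s≤s z≤n) 2≤p²

  L-monic : coeff L p² ≈ 1#
  L-monic = begin
    coeff L p²
      ≈⟨ trans (coeff-+ₚ (X^ p² -ₚ (1# + β) ·ₚ X^ p) (β ·ₚ X) p²) (+-cong (coeff--ₚ (X^ p²) _ p²) (coeff-·ₚ β X p²)) ⟩
    (coeff (X^ p²) p² - coeff ((1# + β) ·ₚ X^ p) p²) + β * coeff X p²
      ≈⟨ +-cong (+-cong (coeff-X^-≡ p²)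
                        (-‿cong (trans (coeff-·ₚ (1# + β) (X^ p) p²) (*-congˡ (coeff-X^-≢ p p² (ℕ.>⇒≢ p<p²))))))
                (*-congˡ (coeff-vanishes (deg-length X 2≤p²) p² ℕ.≤-refl)) ⟩
    (1# - (1# + β) * 0#) + β * 0#
      ≈⟨ solve 2 (λ o c → (o :- (o :+ c) :* con (+ 0)) :+ c :* con (+ 0) := o) refl 1# β ⟩
    1# ∎
    where open ≈-Reasoning

  deg-L : deg L < suc p²
  deg-L = deg-+ₚ (deg-+ₚ (deg-X^ p²) (deg-·ₚ (- 1#) (deg-·ₚ (1# + β) (deg-mono (s≤s (ℕ.<⇒≤ p<p²)) (deg-X^ p)))))
                 (deg-·ₚ β (deg-length X (ℕ.m≤n⇒m≤1+n 2≤p²)))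

  private
    *-cancelˡ-≉0 : ∀ {x y} → ¬ x ≈ 0# → x * y ≈ 0# → y ≈ 0#
    *-cancelˡ-≉0 {x} {y} x≉0 xy≈0 with IsFieldCR.inverse F-field x x≉0
    ... | x⁻¹ , xx⁻¹≈1 = begin
      y               ≈⟨ *-identityˡ y ⟨
      1# * y          ≈⟨ *-congʳ (trans (*-comm x⁻¹ x) xx⁻¹≈1) ⟨
      (x⁻¹ * x) * y   ≈⟨ *-assoc x⁻¹ x y ⟩
      x⁻¹ * (x * y)   ≈⟨ *-congˡ xy≈0 ⟩
      x⁻¹ * 0#        ≈⟨ zeroʳ x⁻¹ ⟩
      0#              ∎
      where open ≈-Reasoning

  open RootBound *-cancelˡ-≉0
  open MonicDivision L p² L-monic deg-L

  vanishes-on-enumeration⇒≈[] : ∀ {t} → deg t < p² → (∀ k → eval t (enumerate k) ≈ 0#) → t ≈ₚ []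
  vanishes-on-enumeration⇒≈[] deg-t vanishes =
    roots⇒≈[] p² enumerate enumerate-injective (λ {k} _ → vanishes k) deg-t

  W-period-of-L : ∀ {w} → W w → L ∘ₚ X+ w ≈ₚ L
  W-period-of-L {w} w∈W = -ₚ≈[]⇒≈ _ _ (vanishes-on-enumeration⇒≈[] (deg-Δ w deg-L) λ k → begin
    eval (Δ w L) (enumerate k)                       ≈⟨ eval-Δ w L (enumerate k) ⟩
    eval L (w + enumerate k) - eval L (enumerate k)  ≈⟨ +-cong (L-vanishes (W-+ w∈W (enumerate∈W k)))
                                                               (-‿cong (L-vanishes (enumerate∈W k))) ⟩
    0# - 0#                                          ≈⟨ -‿inverseʳ 0# ⟩
    0#                                               ∎)
    where
    open ≈-Reasoning
    L-vanishes : ∀ {v} → W v → eval L v ≈ 0#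
    L-vanishes v∈W = trans (eval-L _) (𝓛-W v∈W)

  Periodic : Poly → Set (c ⊔ ℓ)
  Periodic g = ∀ {w} → W w → g ∘ₚ X+ w ≈ₚ g

  periodic⇒constant : ∀ {r} → deg r < p² → Periodic r → r ≈ₚ const (eval r 0#)
  periodic⇒constant {r} deg-r r-periodic = -ₚ≈[]⇒≈ r (const r₀) (vanishes-on-enumeration⇒≈[] deg-r-r₀ λ k → begin
    eval (r -ₚ const r₀) (enumerate k)                     ≈⟨ eval--ₚ r (const r₀) (enumerate k) ⟩
    eval r (enumerate k) - eval (const r₀) (enumerate k)   ≈⟨ +-cong (eval-period r (r-periodic (enumerate∈W k)))
                                                                     (-‿cong (eval-const r₀ _)) ⟩
    r₀ - r₀                                                ≈⟨ -‿inverseʳ r₀ ⟩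
    0#                                                     ∎)
    where
    open ≈-Reasoning
    r₀ = eval r 0#
    deg-r-r₀ : deg r -ₚ const r₀ < p²
    deg-r-r₀ = deg-+ₚ deg-r (deg-·ₚ (- 1#) (deg-mono 1≤p² (deg-const r₀)))

  periodic-divide : ∀ {g k r} → Periodic g → deg r < p² → g ≈ₚ r +ₚ k *ₚ L → Periodic k × Periodic r
  periodic-divide {g} {k} {r} g-periodic deg-r g≈r+kL =
    (λ w∈W → -ₚ≈[]⇒≈ _ _ (proj₁ (Δ≈[] w∈W))) , (λ w∈W → -ₚ≈[]⇒≈ _ _ (proj₂ (Δ≈[] w∈W)))
    where
    Δ≈[] : ∀ {w} → W w → Δ w k ≈ₚ [] × Δ w r ≈ₚ []
    Δ≈[] {w} w∈W = monic-cancel (Δ w k) (Δ w r) (deg-Δ w (deg-mono (ℕ.n≤1+n p²) deg-r)) (begin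
      Δ w r +ₚ Δ w k *ₚ L       ≈⟨ +ₚ-congˡ (Δ w r) (Δ-*ₚ k (W-period-of-L w∈W)) ⟨
      Δ w r +ₚ Δ w (k *ₚ L)     ≈⟨ Δ-+ₚ w r (k *ₚ L) ⟨
      Δ w (r +ₚ k *ₚ L)         ≈⟨ Δ-cong w g≈r+kL ⟨
      Δ w g                     ≈⟨ +ₚ-congʳ (-ₚ g) (g-periodic w∈W) ⟩
      g -ₚ g                    ≈⟨ -ₚ-inverseʳ g ⟩
      []                        ∎)
      where open ≈ₚ-Reasoning

  periodic⇒∘L : ∀ N g → deg g < N → Periodic g → ∃ λ f → g ≈ₚ f ∘ₚ L
  periodic⇒∘L zero    g deg-g _          = [] , deg<0⇒≈[] deg-g
  periodic⇒∘L (suc N) g deg-g g-periodic = eval remainder 0# ∷ f , (begin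
    g                                           ≈⟨ ≈remainder+quotient*L ⟩
    remainder +ₚ quotient *ₚ L                  ≈⟨ +ₚ-cong (periodic⇒constant deg-remainder (proj₂ periodic-parts))
                                                           (*ₚ-congˡ L quotient≈f∘L) ⟩
    const (eval remainder 0#) +ₚ (f ∘ₚ L) *ₚ L  ≈⟨ +ₚ-congˡ (const (eval remainder 0#)) (*ₚ-comm (f ∘ₚ L) L) ⟩
    (eval remainder 0# ∷ f) ∘ₚ L                ∎)
    where
    open ≈ₚ-Reasoning
    open Division (divide N g (deg-mono (ℕ.+-monoˡ-≤ N 1≤p²) deg-g))
    periodic-parts = periodic-divide {g} {quotient} {remainder} g-periodic deg-remainder ≈remainder+quotient*L
    open Σ (periodic⇒∘L N quotient deg-quotient (proj₁ periodic-parts)) renaming (proj₁ to f; proj₂ to quotient≈f∘L)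

corollary2p6 : ∀ {c ℓ ℓ′} (F : CommutativeRing c ℓ) → IsFieldCR F →
  let open CommutativeRing F
      open FieldOps F
  in IsFinite →
     (p : ℕ) → HasCharacteristic p →
     (S : Pred Carrier ℓ′) → IsPrimeSubspace S → S 1# →
     (a : Carrier) → S a → ¬ InPrimeField a →
     (g : Poly) → (∀ s → S s → (g ∘ₚ (s ∷ 1# ∷ [])) ≈ₚ g) →
     ∃ λ (f : Poly) →
       g ≈ₚ (f ∘ₚ ((X^ (p *ℕ p) -ₚ ((1# + ((a - (a ^ p)) ^ (p ∸ 1))) ·ₚ X^ p))
                   +ₚ (((a - (a ^ p)) ^ (p ∸ 1)) ·ₚ X)))
corollary2p6 F F-field _ p char-p S S-subspace S∋1 a S∋a a∉𝔽ₚ g S-invariant =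
  periodic⇒∘L (length g) g (deg-length g ℕ.≤-refl) (λ w∈W → S-invariant _ (W⊆ S-subspace S∋1 S∋a w∈W))
  where
  open SubspacePolynomial F F-field char-p a a∉𝔽ₚ
  open PrimeSubfieldPlane F F-field char-p a a∉𝔽ₚ using (W⊆)
  open Polynomials F using (deg-length)
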